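{- Let $k\geqslant 1$ and let $D$ be the derivation on $\mathbb{Q}[x_1,\ldots,x_{k+1}]$ (linear, satisfying $D(uv)=D(u)v+uD(v)$) determined by $D(x_i)=e_{k+1}:=x_1x_2\cdots x_{k+1}$ for all $1\leqslant i\leqslant k+1$. Then for all $n\geqslant 1$, $$D^n(x_1)=C_n(x_1,x_2,\ldots,x_{k+1}):=\sum_{\sigma\in\mathcal{Q}_n(k)}x_1^{\mathrm{plat}_1(\sigma)}x_2^{\mathrm{plat}_2(\sigma)}\cdots x_{k-1}^{\mathrm{plat}_{k-1}(\sigma)}x_k^{\mathrm{des}(\sigma)}x_{k+1}^{\mathrm{asc}(\sigma)}.$$
   Context: A $k$-Stirling permutation of order $n$ is a permutation $\sigma=\sigma_1\sigma_2\cdots\sigma_{kn}$ of the multiset $\{1^k,2^k,\ldots,n^k\}$ (each $i$ appearing $k$ times) such that for each $i\in[n]$ all entries between two occurrences of $i$ are at least $i$; $\mathcal{Q}_n(k)$ denotes the set of them. Set $\sigma_0=\sigma_{kn+1}=0$. For $0\leqslant i\leqslant kn$, the index $i$ is an ascent if $\sigma_i<\sigma_{i+1}$, a descent if $\sigma_i>\sigma_{i+1}$, and a plateau if $\sigma_i=\sigma_{i+1}$; $\mathrm{asc}(\sigma)$, $\mathrm{des}(\sigma)$ count these. A plateau $i$ is a $j$-plateau if there are exactly $j-1$ indices $\ell<i$ with $\sigma_\ell=\sigma_i$; $\mathrm{plat}_j(\sigma)$ is the number of $j$-plateaux (only $1\leqslant j\leqslant k-1$ occur). -}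

module Defs where

open import Data.Nat as ℕ using (ℕ; zero; suc; _∸_; _<ᵇ_; _≡ᵇ_)
open import Data.Bool using (Bool; true; false; if_then_else_; _∧_)
open import Data.List as L using (List; []; _∷_; _++_; concatMap; map; upTo; filter; length; foldr)
open import Data.Vec as V using (Vec)
import Data.Vec.Properties as VP
open import Data.Fin using (Fin; toℕ)
open import Data.Integer using (+_)
open import Data.Product using (_×_; _,_)
open import Data.Rational as Q using (ℚ; 0ℚ; 1ℚ)
open import Relation.Nullary.Decidable using (does)
open import Relation.Binary.PropositionalEquality using (_≡_)

-- A monomial is its exponent vector (entry t = exponent of x_{t+1}).
-- A polynomial is a finite formal sum (list) of coefficient/monomial
-- terms; two polynomials are equal iff every monomial has the same
-- total coefficient.

Monomial : ℕ → Set
Monomial m = Vec ℕ m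

Poly : ℕ → Set
Poly m = List (ℚ × Monomial m)

coeff : ∀ {m} → Poly m → Monomial m → ℚ
coeff [] μ = 0ℚ
coeff ((c , ν) ∷ p) μ =
  if does (VP.≡-dec ℕ._≟_ ν μ) then c Q.+ coeff p μ else coeff p μ

infix 4 _≈ₚ_
_≈ₚ_ : ∀ {m} → Poly m → Poly m → Set
p ≈ₚ q = ∀ μ → coeff p μ ≡ coeff q μ

ℕtoℚ : ℕ → ℚ
ℕtoℚ n = (+ n) Q./ 1

var : ∀ {m} → Fin m → Poly m
var {m} t = (1ℚ , V.tabulate (λ s → if does (toℕ s ℕ.≟ toℕ t) then 1 else 0)) ∷ []

-- It is the Q-linear extension of its
-- value on monomials given by the Leibniz rule:
--   D(x^a) = Σ_i a_i x^(a - ε_i) · e_{k+1}.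

Dterm : ∀ {m} → ℚ × Monomial m → Poly m
Dterm {m} (c , a) = L.map term (L.allFin m)
  where
  term : Fin m → ℚ × Monomial m
  term i = (c Q.* ℕtoℚ (V.lookup a i)
           , V.tabulate (λ s → suc (if does (toℕ s ℕ.≟ toℕ i)
                                      then V.lookup a s ∸ 1
                                      else V.lookup a s)))

D : ∀ {m} → Poly m → Poly m
D p = concatMap Dterm p

Dⁿ : ∀ {m} → ℕ → Poly m → Poly m
Dⁿ zero p = p
Dⁿ (suc n) p = D (Dⁿ n p)

words : ℕ → ℕ → List (List ℕ)
words n zero = [] ∷ []
words n (suc len) =
  concatMap (λ w → map (λ a → suc a ∷ w) (upTo n)) (words n len)

countᵇ : (ℕ → Bool) → List ℕ → ℕ
countᵇ P xs = length (filter (λ x → Data.Bool._≟_ (P x) true) xs)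

-- σ_i with the convention σ_0 = σ_{kn+1} = 0 (1-based positions)
at : List ℕ → ℕ → ℕ
at w zero = 0
at [] (suc i) = 0
at (x ∷ w) (suc zero) = x
at (x ∷ w) (suc (suc i)) = at w (suc i)

allᵇ : (ℕ → Bool) → List ℕ → Bool
allᵇ P = foldr (λ x b → P x ∧ b) true

range : ℕ → ℕ → List ℕ
range a b = map (λ i → a ℕ.+ i) (upTo (b ∸ a))

-- σ is a permutation of {1^k,...,n^k}: length kn, letters in [n]
-- (guaranteed by 'words'), each i ∈ [n] occurring exactly k times
isMultisetPerm : ℕ → ℕ → List ℕ → Bool
isMultisetPerm k n σ =
  allᵇ (λ i → countᵇ (λ x → x ≡ᵇ i) σ ≡ᵇ k) (range 1 (suc n))

isStirling : List ℕ → Bool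
isStirling σ =
  allᵇ (λ p → allᵇ (λ r →
      if at σ p ≡ᵇ at σ r
      then allᵇ (λ q → ℕ._≤ᵇ_ (at σ p) (at σ q)) (range (suc p) r)
      else true)
    (range (suc p) (suc (length σ))))
  (range 1 (suc (length σ)))

𝒬 : ℕ → ℕ → List (List ℕ)
𝒬 n k = filter (λ σ → Data.Bool._≟_ (isMultisetPerm k n σ ∧ isStirling σ) true)
              (words n (k ℕ.* n))

-- statistics (indices i range over 0 ≤ i ≤ kn)
indices : List ℕ → List ℕ
indices σ = upTo (suc (length σ))

asc : List ℕ → ℕ
asc σ = countᵇ (λ i → at σ i <ᵇ at σ (suc i)) (indices σ)

des : List ℕ → ℕ
des σ = countᵇ (λ i → at σ (suc i) <ᵇ at σ i) (indices σ)

plat : ℕ → List ℕ → ℕ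
plat j σ = countᵇ (λ i → (at σ i ≡ᵇ at σ (suc i))
                       ∧ (countᵇ (λ ℓ → at σ ℓ ≡ᵇ at σ i) (upTo i) ≡ᵇ (j ∸ 1)))
                  (indices σ)

weight : (k : ℕ) → List ℕ → Monomial (suc k)
weight k σ = V.tabulate (λ t →
  if toℕ t ≡ᵇ k then asc σ
  else if suc (toℕ t) ≡ᵇ k then des σ
  else plat (suc (toℕ t)) σ)

C : (k n : ℕ) → Poly (suc k)
C k n = map (λ σ → (1ℚ , weight k σ)) (𝒬 n k)

-- Both sides are compared coefficientwise. By the Leibniz rule, the coefficient of x^μ in D p is
-- Σ_i μ_i · [x_i x^μ / e] p, provided e divides x^μ. On the other side, every σ ∈ 𝒬_{n+1}(k) arises
-- in exactly one way by inserting the block (n+1)^k into one of the kn + 1 gaps of some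
-- σ′ ∈ 𝒬_n(k). Label each gap of σ′ by the variable it contributes to the weight (ascent x_{k+1},
-- descent x_k, j-plateau x_j): filling a gap labelled x_i with the block removes that factor and
-- creates one ascent, one descent and one j-plateau for each j < k, i.e. multiplies the weight by
-- e / x_i. So the number of σ of weight μ obeys the same recurrence as the coefficients of Dⁿ x₁,
-- and both start from D x₁ = e = C₁.

module Submission where

open import Algebra.Bundles using (CommutativeMonoid)
open import Data.Bool using (Bool; true; false; if_then_else_; _∧_)
import Data.Bool as Bool
open import Data.Empty using (⊥; ⊥-elim)
open import Data.Fin as Fin using (Fin; toℕ; zero)
import Data.Fin.Properties as Finₚ
import Data.Integer as ℤ
import Data.Integer.Properties as ℤₚ
open import Data.List as List
  using (List; []; _∷_; _++_; concatMap; map; upTo; length; replicate; applyUpTo; take; drop; allFin)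
import Data.List.Properties as Listₚ
open import Data.List.Membership.Propositional using (_∈_; find)
open import Data.List.Membership.Propositional.Properties
open import Data.List.Membership.Propositional.Properties.WithK using (unique∧set⇒bag)
open import Data.List.Relation.Binary.BagAndSetEquality using (∼bag⇒↭)
open import Data.List.Relation.Binary.Permutation.Propositional as Perm using (_↭_; prep; swap)
open import Data.List.Relation.Unary.All as All using (All; []; _∷_)
import Data.List.Relation.Unary.All.Properties as Allₚ
open import Data.List.Relation.Unary.AllPairs using ([]; _∷_)
open import Data.List.Relation.Unary.Any as Any using (here; there)
open import Data.List.Relation.Unary.Unique.Propositional using (Unique)
import Data.List.Relation.Unary.Unique.Propositional.Properties as Uniqueₚ
open import Data.Nat as ℕ
  using (ℕ; zero; suc; _+_; _*_; _∸_; _≤_; _<_; z≤n; s≤s; _≡ᵇ_; _<ᵇ_; _≤ᵇ_)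
open import Data.Nat.Coprimality using (1-coprimeTo)
import Data.Nat.Coprimality as Coprime
import Data.Nat.Properties as ℕₚ
open import Data.Product using (_×_; _,_; proj₁; proj₂; ∃; ∃₂)
open import Data.Rational as ℚ using (ℚ; 0ℚ; 1ℚ; mkℚ)
import Data.Rational.Properties as ℚₚ
import Data.Rational.Unnormalised as ℚᵘ
import Data.Rational.Unnormalised.Properties as ℚᵘₚ
open import Data.Sum using (_⊎_; inj₁; inj₂)
open import Data.Vec using (Vec; lookup; tabulate)
import Data.Vec.Properties as Vecₚ
import Data.Vec.Relation.Unary.All as VecAll
import Data.Vec.Relation.Unary.All.Properties as VecAllₚ
open import Function using (_∘_)
open import Function.Bundles using (mk⇔)
open import Relation.Binary.Definitions using (tri<; tri≈; tri>)
open import Relation.Binary.PropositionalEquality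
open import Relation.Nullary using (Dec; ¬_; yes; no)
open import Relation.Nullary.Decidable using (does; dec-true; dec-false)

open import Defs

import Algebra.Properties.CommutativeSemigroup ℕₚ.+-commutativeSemigroup as ℕ+
import Algebra.Properties.CommutativeSemigroup
  (CommutativeMonoid.commutativeSemigroup ℚₚ.+-0-commutativeMonoid) as ℚ+
import Algebra.Properties.CommutativeSemigroup
  (CommutativeMonoid.commutativeSemigroup ℚₚ.*-1-commutativeMonoid) as ℚ*

⟦_⟧ : Bool → ℕ
⟦ true ⟧ = 1
⟦ false ⟧ = 0

∑ : ∀ {a} {A : Set a} → List A → (A → ℕ) → ℕ
∑ [] f = 0
∑ (x ∷ xs) f = f x + ∑ xs f

module _ {a} {A : Set a} where

  ∑-++ : (xs ys : List A) (f : A → ℕ) → ∑ (xs ++ ys) f ≡ ∑ xs f + ∑ ys f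
  ∑-++ [] ys f = refl
  ∑-++ (x ∷ xs) ys f = trans (cong (f x +_) (∑-++ xs ys f)) (sym (ℕₚ.+-assoc (f x) _ _))

  ∑-cong : (xs : List A) {f g : A → ℕ} → (∀ {x} → x ∈ xs → f x ≡ g x) → ∑ xs f ≡ ∑ xs g
  ∑-cong [] h = refl
  ∑-cong (x ∷ xs) h = cong₂ _+_ (h (here refl)) (∑-cong xs (h ∘ there))

  ∑-+ : (xs : List A) (f g : A → ℕ) → ∑ xs (λ x → f x + g x) ≡ ∑ xs f + ∑ xs g
  ∑-+ [] f g = refl
  ∑-+ (x ∷ xs) f g = trans (cong (f x + g x +_) (∑-+ xs f g)) (ℕ+.interchange (f x) (g x) _ _)

  ∑-*ˡ : (xs : List A) (c : ℕ) (f : A → ℕ) → ∑ xs (λ x → c * f x) ≡ c * ∑ xs f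
  ∑-*ˡ [] c f = sym (ℕₚ.*-zeroʳ c)
  ∑-*ˡ (x ∷ xs) c f = trans (cong (c * f x +_) (∑-*ˡ xs c f)) (sym (ℕₚ.*-distribˡ-+ c (f x) _))

  ∑-0 : (xs : List A) → ∑ xs (λ _ → 0) ≡ 0
  ∑-0 [] = refl
  ∑-0 (x ∷ xs) = ∑-0 xs

  ∑-↭ : {xs ys : List A} (f : A → ℕ) → xs ↭ ys → ∑ xs f ≡ ∑ ys f
  ∑-↭ f Perm.refl = refl
  ∑-↭ f (prep x p) = cong (f x +_) (∑-↭ f p)
  ∑-↭ f (swap {xs} x y p) = trans (ℕ+.x∙yz≈y∙xz (f x) (f y) (∑ xs f)) (cong (λ s → f y + (f x + s)) (∑-↭ f p))
  ∑-↭ f (Perm.trans p q) = trans (∑-↭ f p) (∑-↭ f q)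

module _ {a b} {A : Set a} {B : Set b} where

  ∑-map : (g : A → B) (xs : List A) (f : B → ℕ) → ∑ (map g xs) f ≡ ∑ xs (λ x → f (g x))
  ∑-map g [] f = refl
  ∑-map g (x ∷ xs) f = cong (f (g x) +_) (∑-map g xs f)

  ∑-concatMap : (g : A → List B) (xs : List A) (f : B → ℕ) →
    ∑ (concatMap g xs) f ≡ ∑ xs (λ x → ∑ (g x) f)
  ∑-concatMap g [] f = refl
  ∑-concatMap g (x ∷ xs) f =
    trans (∑-++ (g x) (concatMap g xs) f) (cong (∑ (g x) f +_) (∑-concatMap g xs f))

  ∑-comm : (xs : List A) (ys : List B) (f : A → B → ℕ) →
    ∑ xs (λ x → ∑ ys (f x)) ≡ ∑ ys (λ y → ∑ xs (λ x → f x y))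
  ∑-comm [] ys f = sym (∑-0 ys)
  ∑-comm (x ∷ xs) ys f =
    trans (cong (∑ ys (f x) +_) (∑-comm xs ys f)) (sym (∑-+ ys (f x) (λ y → ∑ xs (λ x → f x y))))

countᵇ-∷ : (P : ℕ → Bool) (x : ℕ) (xs : List ℕ) → countᵇ P (x ∷ xs) ≡ ⟦ P x ⟧ + countᵇ P xs
countᵇ-∷ P x xs with P x
... | true = refl
... | false = refl

countᵇ-∑ : (P : ℕ → Bool) (xs : List ℕ) → countᵇ P xs ≡ ∑ xs (λ x → ⟦ P x ⟧)
countᵇ-∑ P [] = refl
countᵇ-∑ P (x ∷ xs) = trans (countᵇ-∷ P x xs) (cong (⟦ P x ⟧ +_) (countᵇ-∑ P xs))

ℕtoℚ-suc : ∀ n → ℕtoℚ (suc n) ≡ 1ℚ ℚ.+ ℕtoℚ n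
ℕtoℚ-suc n = ℚₚ.toℚᵘ-injective (ℚᵘₚ.≃-trans unnormalised (ℚᵘₚ.≃-sym (ℚₚ.toℚᵘ-homo-+ 1ℚ (ℕtoℚ n))))
  where
  asMkℚ : ∀ m → ℕtoℚ m ≡ mkℚ (ℤ.+ m) 0 (Coprime.sym (1-coprimeTo m))
  asMkℚ m = ℚₚ.normalize-coprime (Coprime.sym (1-coprimeTo m))
  unnormalised : ℚ.toℚᵘ (ℕtoℚ (suc n)) ℚᵘ.≃ (ℚ.toℚᵘ 1ℚ ℚᵘ.+ ℚ.toℚᵘ (ℕtoℚ n))
  unnormalised rewrite asMkℚ (suc n) | asMkℚ n =
    ℚᵘ.*≡* (cong (ℤ._* ℤ.+ 1) (cong₂ ℤ._+_ (sym (ℤₚ.*-identityʳ (ℤ.+ 1))) (sym (ℤₚ.*-identityʳ (ℤ.+ n)))))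

ℕtoℚ-+ : ∀ a b → ℕtoℚ (a + b) ≡ ℕtoℚ a ℚ.+ ℕtoℚ b
ℕtoℚ-+ zero b = sym (ℚₚ.+-identityˡ (ℕtoℚ b))
ℕtoℚ-+ (suc a) b = begin
  ℕtoℚ (suc (a + b))            ≡⟨ ℕtoℚ-suc (a + b) ⟩
  1ℚ ℚ.+ ℕtoℚ (a + b)           ≡⟨ cong (1ℚ ℚ.+_) (ℕtoℚ-+ a b) ⟩
  1ℚ ℚ.+ (ℕtoℚ a ℚ.+ ℕtoℚ b)   ≡⟨ ℚₚ.+-assoc 1ℚ (ℕtoℚ a) (ℕtoℚ b) ⟨
  (1ℚ ℚ.+ ℕtoℚ a) ℚ.+ ℕtoℚ b   ≡⟨ cong (ℚ._+ ℕtoℚ b) (ℕtoℚ-suc a) ⟨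
  ℕtoℚ (suc a) ℚ.+ ℕtoℚ b       ∎
  where open ≡-Reasoning

ℕtoℚ-* : ∀ a b → ℕtoℚ (a * b) ≡ ℕtoℚ a ℚ.* ℕtoℚ b
ℕtoℚ-* zero b = sym (ℚₚ.*-zeroˡ (ℕtoℚ b))
ℕtoℚ-* (suc a) b = begin
  ℕtoℚ (b + a * b)                        ≡⟨ ℕtoℚ-+ b (a * b) ⟩
  ℕtoℚ b ℚ.+ ℕtoℚ (a * b)                 ≡⟨ cong (ℕtoℚ b ℚ.+_) (ℕtoℚ-* a b) ⟩
  ℕtoℚ b ℚ.+ ℕtoℚ a ℚ.* ℕtoℚ b            ≡⟨ cong (ℚ._+ ℕtoℚ a ℚ.* ℕtoℚ b) (ℚₚ.*-identityˡ (ℕtoℚ b)) ⟨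
  1ℚ ℚ.* ℕtoℚ b ℚ.+ ℕtoℚ a ℚ.* ℕtoℚ b    ≡⟨ ℚₚ.*-distribʳ-+ (ℕtoℚ b) 1ℚ (ℕtoℚ a) ⟨
  (1ℚ ℚ.+ ℕtoℚ a) ℚ.* ℕtoℚ b             ≡⟨ cong (ℚ._* ℕtoℚ b) (ℕtoℚ-suc a) ⟨
  ℕtoℚ (suc a) ℚ.* ℕtoℚ b                 ∎
  where open ≡-Reasoning

∑ℚ : ∀ {a} {A : Set a} → List A → (A → ℚ) → ℚ
∑ℚ [] f = 0ℚ
∑ℚ (x ∷ xs) f = f x ℚ.+ ∑ℚ xs f

module _ {a} {A : Set a} where

  ℕtoℚ-∑ : (xs : List A) (f : A → ℕ) → ℕtoℚ (∑ xs f) ≡ ∑ℚ xs (λ x → ℕtoℚ (f x))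
  ℕtoℚ-∑ [] f = refl
  ℕtoℚ-∑ (x ∷ xs) f = trans (ℕtoℚ-+ (f x) (∑ xs f)) (cong (ℕtoℚ (f x) ℚ.+_) (ℕtoℚ-∑ xs f))

  ∑ℚ-cong : (xs : List A) {f g : A → ℚ} → (∀ x → f x ≡ g x) → ∑ℚ xs f ≡ ∑ℚ xs g
  ∑ℚ-cong [] h = refl
  ∑ℚ-cong (x ∷ xs) h = cong₂ ℚ._+_ (h x) (∑ℚ-cong xs h)

  ∑ℚ-+ : (xs : List A) (f g : A → ℚ) → ∑ℚ xs (λ x → f x ℚ.+ g x) ≡ ∑ℚ xs f ℚ.+ ∑ℚ xs g
  ∑ℚ-+ [] f g = sym (ℚₚ.+-identityˡ 0ℚ)
  ∑ℚ-+ (x ∷ xs) f g =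
    trans (cong ((f x ℚ.+ g x) ℚ.+_) (∑ℚ-+ xs f g)) (ℚ+.interchange (f x) (g x) _ _)

  ∑ℚ-0 : (xs : List A) (f : A → ℚ) → (∀ {x} → x ∈ xs → f x ≡ 0ℚ) → ∑ℚ xs f ≡ 0ℚ
  ∑ℚ-0 [] f h = refl
  ∑ℚ-0 (x ∷ xs) f h = trans (cong₂ ℚ._+_ (h (here refl)) (∑ℚ-0 xs f (h ∘ there))) (ℚₚ.+-identityˡ 0ℚ)

-- Coefficients and the action of D on them

δ : ∀ {m} → Monomial m → Monomial m → ℕ
δ ν μ = if does (Vecₚ.≡-dec ℕ._≟_ ν μ) then 1 else 0

δ-refl : ∀ {m} (μ : Monomial m) → δ μ μ ≡ 1
δ-refl μ rewrite dec-true (Vecₚ.≡-dec ℕ._≟_ μ μ) refl = refl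

δ-≢ : ∀ {m} {ν μ : Monomial m} → ν ≢ μ → δ ν μ ≡ 0
δ-≢ {ν = ν} {μ} ν≢μ rewrite dec-false (Vecₚ.≡-dec ℕ._≟_ ν μ) ν≢μ = refl

termCoeff : ∀ {m} → ℚ × Monomial m → Monomial m → ℚ
termCoeff (c , ν) μ = if does (Vecₚ.≡-dec ℕ._≟_ ν μ) then c else 0ℚ

termCoeff-δ : ∀ {m} c (ν μ : Monomial m) → termCoeff (c , ν) μ ≡ c ℚ.* ℕtoℚ (δ ν μ)
termCoeff-δ c ν μ with Vecₚ.≡-dec ℕ._≟_ ν μ
... | yes _ = sym (ℚₚ.*-identityʳ c)
... | no _ = sym (ℚₚ.*-zeroʳ c)

coeff-∷ : ∀ {m} (t : ℚ × Monomial m) p μ → coeff (t ∷ p) μ ≡ termCoeff t μ ℚ.+ coeff p μ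
coeff-∷ (c , ν) p μ with Vecₚ.≡-dec ℕ._≟_ ν μ
... | yes _ = refl
... | no _ = sym (ℚₚ.+-identityˡ _)

coeff-++ : ∀ {m} (p q : Poly m) μ → coeff (p ++ q) μ ≡ coeff p μ ℚ.+ coeff q μ
coeff-++ [] q μ = sym (ℚₚ.+-identityˡ _)
coeff-++ (t ∷ p) q μ = begin
  coeff (t ∷ (p ++ q)) μ                          ≡⟨ coeff-∷ t (p ++ q) μ ⟩
  termCoeff t μ ℚ.+ coeff (p ++ q) μ              ≡⟨ cong (termCoeff t μ ℚ.+_) (coeff-++ p q μ) ⟩
  termCoeff t μ ℚ.+ (coeff p μ ℚ.+ coeff q μ)     ≡⟨ ℚₚ.+-assoc (termCoeff t μ) _ _ ⟨
  (termCoeff t μ ℚ.+ coeff p μ) ℚ.+ coeff q μ     ≡⟨ cong (ℚ._+ coeff q μ) (coeff-∷ t p μ) ⟨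
  coeff (t ∷ p) μ ℚ.+ coeff q μ                   ∎
  where open ≡-Reasoning

coeff-map : ∀ {a} {A : Set a} {m} (f : A → ℚ × Monomial m) (xs : List A) μ →
  coeff (map f xs) μ ≡ ∑ℚ xs (λ x → termCoeff (f x) μ)
coeff-map f [] μ = refl
coeff-map f (x ∷ xs) μ = trans (coeff-∷ (f x) (map f xs) μ) (cong (termCoeff (f x) μ ℚ.+_) (coeff-map f xs μ))

module _ {m : ℕ} where

  e : Monomial m
  e = tabulate (λ _ → 1)

  -- bump a j is the exponent vector of e · x^a / x_{j+1}, the monomial of the Leibniz term for x_{j+1}
  bump : Monomial m → ℕ → Monomial m
  bump a j = tabulate (λ s → suc (if does (toℕ s ℕ.≟ j) then lookup a s ∸ 1 else lookup a s))

  -- lower i μ is the exponent vector of x_{i+1} · x^μ / e, the only monomial whose bump at i can be μ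
  lower : Fin m → Monomial m → Monomial m
  lower i μ = tabulate (λ s → if does (toℕ s ℕ.≟ toℕ i) then lookup μ s else lookup μ s ∸ 1)

  Positive : Monomial m → Set
  Positive = VecAll.All (1 ≤_)

  -- Zero unless e divides x^μ, as every term of D p is a multiple of e.
  leibnizCoeff : Fin m → Monomial m → ℕ
  leibnizCoeff i μ = if does (VecAll.all? (1 ℕ.≤?_) μ) then lookup μ i else 0

suc[n∸1]≡n : ∀ {n} → 1 ≤ n → suc (n ∸ 1) ≡ n
suc[n∸1]≡n (s≤s z≤n) = refl

lookup-ext : ∀ {m} (u v : Vec ℕ m) → (∀ s → lookup u s ≡ lookup v s) → u ≡ v
lookup-ext u v h = trans (sym (Vecₚ.tabulate∘lookup u)) (trans (Vecₚ.tabulate-cong h) (Vecₚ.tabulate∘lookup v))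

lookup-bump : ∀ {m} (a : Monomial m) j s → lookup (bump a j) s ≡ suc (if toℕ s ≡ᵇ j then lookup a s ∸ 1 else lookup a s)
lookup-bump a j = Vecₚ.lookup∘tabulate (λ s → suc (if does (toℕ s ℕ.≟ j) then lookup a s ∸ 1 else lookup a s))

module _ {m : ℕ} (i : Fin m) where

  lookup-bump-≡ : ∀ (a : Monomial m) → lookup (bump a (toℕ i)) i ≡ suc (lookup a i ∸ 1)
  lookup-bump-≡ a rewrite lookup-bump a (toℕ i) i | dec-true (toℕ i ℕ.≟ toℕ i) refl = refl

  lookup-bump-≢ : ∀ (a : Monomial m) s → toℕ s ≢ toℕ i → lookup (bump a (toℕ i)) s ≡ suc (lookup a s)
  lookup-bump-≢ a s s≢i rewrite lookup-bump a (toℕ i) s | dec-false (toℕ s ℕ.≟ toℕ i) s≢i = refl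

  lookup-lower-≡ : ∀ (μ : Monomial m) → lookup (lower i μ) i ≡ lookup μ i
  lookup-lower-≡ μ rewrite Vecₚ.lookup∘tabulate (λ s → if does (toℕ s ℕ.≟ toℕ i) then lookup μ s else lookup μ s ∸ 1) i
                         | dec-true (toℕ i ℕ.≟ toℕ i) refl = refl

  lookup-lower-≢ : ∀ (μ : Monomial m) s → toℕ s ≢ toℕ i → lookup (lower i μ) s ≡ lookup μ s ∸ 1
  lookup-lower-≢ μ s s≢i rewrite Vecₚ.lookup∘tabulate (λ s → if does (toℕ s ℕ.≟ toℕ i) then lookup μ s else lookup μ s ∸ 1) s
                               | dec-false (toℕ s ℕ.≟ toℕ i) s≢i = refl

  bump-positive : ∀ (a : Monomial m) → Positive (bump a (toℕ i))
  bump-positive a = VecAllₚ.tabulate⁺ (λ _ → s≤s z≤n)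

  lower-bump : ∀ (a : Monomial m) → 1 ≤ lookup a i → lower i (bump a (toℕ i)) ≡ a
  lower-bump a aᵢ>0 = lookup-ext _ _ pointwise
    where
    pointwise : ∀ s → lookup (lower i (bump a (toℕ i))) s ≡ lookup a s
    pointwise s with toℕ s ℕ.≟ toℕ i
    ... | yes s≡i rewrite Finₚ.toℕ-injective s≡i =
      trans (lookup-lower-≡ (bump a (toℕ i))) (trans (lookup-bump-≡ a) (suc[n∸1]≡n aᵢ>0))
    ... | no s≢i = trans (lookup-lower-≢ (bump a (toℕ i)) s s≢i) (cong (_∸ 1) (lookup-bump-≢ a s s≢i))

  bump-lower : ∀ (μ : Monomial m) → Positive μ → bump (lower i μ) (toℕ i) ≡ μ
  bump-lower μ μ>0 = lookup-ext _ _ pointwise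
    where
    pointwise : ∀ s → lookup (bump (lower i μ) (toℕ i)) s ≡ lookup μ s
    pointwise s with toℕ s ℕ.≟ toℕ i
    ... | yes s≡i rewrite Finₚ.toℕ-injective s≡i =
      trans (lookup-bump-≡ (lower i μ)) (trans (cong (λ x → suc (x ∸ 1)) (lookup-lower-≡ μ)) (suc[n∸1]≡n (VecAllₚ.lookup⁺ μ>0 i)))
    ... | no s≢i = trans (lookup-bump-≢ (lower i μ) s s≢i) (trans (cong suc (lookup-lower-≢ μ s s≢i)) (suc[n∸1]≡n (VecAllₚ.lookup⁺ μ>0 s)))

module _ {m : ℕ} (i : Fin m) where

  leibnizCoeff-positive : ∀ {μ} → Positive μ → leibnizCoeff i μ ≡ lookup μ i
  leibnizCoeff-positive {μ} μ>0 rewrite dec-true (VecAll.all? (1 ℕ.≤?_) μ) μ>0 = refl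

  leibnizTerm-vanishes : ∀ a μ → (Positive μ → a ≢ lower i μ) → leibnizCoeff i μ * δ a (lower i μ) ≡ 0
  leibnizTerm-vanishes a μ h with VecAll.all? (1 ℕ.≤?_) μ
  ... | no _ = refl
  ... | yes μ>0 = trans (cong (lookup μ i *_) (δ-≢ (h μ>0))) (ℕₚ.*-zeroʳ (lookup μ i))

-- The Leibniz term of x^a for x_{i+1} hits μ exactly when a is lower i μ; the exponent a_i
-- that the rule multiplies by is then the exponent μ_i read off the target.
leibniz-δ : ∀ {m} (a μ : Monomial m) (i : Fin m) →
  lookup a i * δ (bump a (toℕ i)) μ ≡ leibnizCoeff i μ * δ a (lower i μ)
leibniz-δ a μ i with lookup a i in aᵢ
... | zero = sym (leibnizTerm-vanishes i a μ λ { μ>0 refl →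
      ℕₚ.n≮n 0 (subst (1 ≤_) (trans (sym (lookup-lower-≡ i μ)) aᵢ) (VecAllₚ.lookup⁺ μ>0 i)) })
... | suc x with Vecₚ.≡-dec ℕ._≟_ (bump a (toℕ i)) μ
...   | no bump≢μ = begin
  suc x * 0                             ≡⟨ ℕₚ.*-zeroʳ (suc x) ⟩
  0                                     ≡⟨ leibnizTerm-vanishes i a μ (λ μ>0 a≡ → bump≢μ (trans (cong (λ b → bump b (toℕ i)) a≡) (bump-lower i μ μ>0))) ⟨
  leibnizCoeff i μ * δ a (lower i μ)    ∎
  where open ≡-Reasoning
...   | yes refl = begin
  suc x * 1                             ≡⟨ cong (λ y → suc y * 1) (cong (_∸ 1) aᵢ) ⟨
  suc (lookup a i ∸ 1) * 1              ≡⟨ cong (_* 1) (lookup-bump-≡ i a) ⟨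
  lookup b i * 1                        ≡⟨ cong₂ _*_ (leibnizCoeff-positive i (bump-positive i a)) (δ-refl a) ⟨
  leibnizCoeff i b * δ a a              ≡⟨ cong (λ c → leibnizCoeff i b * δ a c) (lower-bump i a (subst (1 ≤_) (sym aᵢ) (s≤s z≤n))) ⟨
  leibnizCoeff i b * δ a (lower i b)    ∎
  where
  open ≡-Reasoning
  b = bump a (toℕ i)

coeff-Dterm : ∀ {m} (t : ℚ × Monomial m) μ →
  coeff (Dterm t) μ ≡ ∑ℚ (allFin m) (λ i → ℕtoℚ (leibnizCoeff i μ) ℚ.* termCoeff t (lower i μ))
coeff-Dterm {m} (c , a) μ = trans (coeff-map _ (allFin m) μ) (∑ℚ-cong (allFin m) λ i → begin
  termCoeff (c ℚ.* A i , bump a (toℕ i)) μ             ≡⟨ termCoeff-δ (c ℚ.* A i) (bump a (toℕ i)) μ ⟩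
  (c ℚ.* A i) ℚ.* ℕtoℚ (δ (bump a (toℕ i)) μ)          ≡⟨ ℚₚ.*-assoc c _ _ ⟩
  c ℚ.* (A i ℚ.* ℕtoℚ (δ (bump a (toℕ i)) μ))          ≡⟨ cong (c ℚ.*_) (ℕtoℚ-* (lookup a i) _) ⟨
  c ℚ.* ℕtoℚ (lookup a i * δ (bump a (toℕ i)) μ)       ≡⟨ cong (λ n → c ℚ.* ℕtoℚ n) (leibniz-δ a μ i) ⟩
  c ℚ.* ℕtoℚ (leibnizCoeff i μ * δ a (lower i μ))      ≡⟨ cong (c ℚ.*_) (ℕtoℚ-* (leibnizCoeff i μ) _) ⟩
  c ℚ.* (L i ℚ.* ℕtoℚ (δ a (lower i μ)))              ≡⟨ ℚ*.x∙yz≈y∙xz c (L i) _ ⟩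
  L i ℚ.* (c ℚ.* ℕtoℚ (δ a (lower i μ)))              ≡⟨ cong (L i ℚ.*_) (termCoeff-δ c a (lower i μ)) ⟨
  L i ℚ.* termCoeff (c , a) (lower i μ)               ∎)
  where
  open ≡-Reasoning
  A = λ i → ℕtoℚ (lookup a i)
  L = λ i → ℕtoℚ (leibnizCoeff i μ)

coeff-D : ∀ {m} (p : Poly m) μ →
  coeff (D p) μ ≡ ∑ℚ (allFin m) (λ i → ℕtoℚ (leibnizCoeff i μ) ℚ.* coeff p (lower i μ))
coeff-D {m} [] μ = sym (∑ℚ-0 (allFin m) _ (λ {i} _ → ℚₚ.*-zeroʳ (ℕtoℚ (leibnizCoeff i μ))))
coeff-D {m} (t ∷ p) μ = begin
  coeff (Dterm t ++ D p) μ                          ≡⟨ coeff-++ (Dterm t) (D p) μ ⟩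
  coeff (Dterm t) μ ℚ.+ coeff (D p) μ              ≡⟨ cong₂ ℚ._+_ (coeff-Dterm t μ) (coeff-D p μ) ⟩
  ∑ℚ Fm (λ i → L i ℚ.* termCoeff t (ν i)) ℚ.+ ∑ℚ Fm (λ i → L i ℚ.* coeff p (ν i))
                                                    ≡⟨ ∑ℚ-+ Fm _ _ ⟨
  ∑ℚ Fm (λ i → L i ℚ.* termCoeff t (ν i) ℚ.+ L i ℚ.* coeff p (ν i))
                                                    ≡⟨ ∑ℚ-cong Fm (λ i → ℚₚ.*-distribˡ-+ (L i) _ _) ⟨
  ∑ℚ Fm (λ i → L i ℚ.* (termCoeff t (ν i) ℚ.+ coeff p (ν i)))
                                                    ≡⟨ ∑ℚ-cong Fm (λ i → cong (L i ℚ.*_) (coeff-∷ t p (ν i))) ⟨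
  ∑ℚ Fm (λ i → L i ℚ.* coeff (t ∷ p) (ν i))        ∎
  where
  open ≡-Reasoning
  Fm = allFin m
  L = λ i → ℕtoℚ (leibnizCoeff i μ)
  ν = λ i → lower i μ

module _ {p} {P : Set p} where

  invert-true : (P? : Dec P) → does P? ≡ true → P
  invert-true (yes p) _ = p

  invert-false : (P? : Dec P) → does P? ≡ false → ¬ P
  invert-false (no ¬p) _ = ¬p

≡ᵇ-refl : ∀ a → (a ≡ᵇ a) ≡ true
≡ᵇ-refl a = dec-true (a ℕ.≟ a) refl

≢⇒≡ᵇ-false : ∀ {a b} → a ≢ b → (a ≡ᵇ b) ≡ false
≢⇒≡ᵇ-false {a} {b} = dec-false (a ℕ.≟ b)

<⇒<ᵇ : ∀ {a b} → a < b → (a <ᵇ b) ≡ true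
<⇒<ᵇ {a} {b} = dec-true (a ℕ.<? b)

≮⇒<ᵇ : ∀ {a b} → ¬ a < b → (a <ᵇ b) ≡ false
≮⇒<ᵇ {a} {b} = dec-false (a ℕ.<? b)

∧-true : ∀ {a b} → a ∧ b ≡ true → a ≡ true × b ≡ true
∧-true {true} {true} _ = refl , refl

allᵇ⁻ : (P : ℕ → Bool) (xs : List ℕ) → allᵇ P xs ≡ true → ∀ {x} → x ∈ xs → P x ≡ true
allᵇ⁻ P (y ∷ xs) h (here refl) = proj₁ (∧-true h)
allᵇ⁻ P (y ∷ xs) h (there x∈) = allᵇ⁻ P xs (proj₂ (∧-true {P y} h)) x∈

allᵇ⁺ : (P : ℕ → Bool) (xs : List ℕ) → (∀ {x} → x ∈ xs → P x ≡ true) → allᵇ P xs ≡ true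
allᵇ⁺ P [] h = refl
allᵇ⁺ P (y ∷ xs) h rewrite h (here refl) = allᵇ⁺ P xs (h ∘ there)

allᵇ-false⁻ : (P : ℕ → Bool) (xs : List ℕ) → allᵇ P xs ≡ false → ∃ λ x → x ∈ xs × P x ≡ false
allᵇ-false⁻ P (y ∷ xs) h with P y in Py
... | false = y , here refl , Py
... | true with allᵇ-false⁻ P xs h
...   | x , x∈ , Px = x , there x∈ , Px

∈-range⁺ : ∀ {a b x} → a ≤ x → x < b → x ∈ range a b
∈-range⁺ {a} {b} {x} a≤x x<b = subst (_∈ range a b) (ℕₚ.m+[n∸m]≡n a≤x)
  (∈-map⁺ (a +_) (∈-upTo⁺ (ℕₚ.∸-monoˡ-< x<b a≤x)))

<∸⇒+< : ∀ a b i → i < b ∸ a → a + i < b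
<∸⇒+< zero b i h = h
<∸⇒+< (suc a) (suc b) i h = s≤s (<∸⇒+< a b i h)

∈-range⁻ : ∀ {a b x} → x ∈ range a b → a ≤ x × x < b
∈-range⁻ {a} {b} m with ∈-map⁻ (a +_) m
... | i , i∈ , refl = ℕₚ.m≤m+n a i , <∸⇒+< a b i (∈-upTo⁻ i∈)

-- The Stirling condition as a forbidden pattern

SmallerBefore : ℕ → List ℕ → Set
SmallerBefore x [] = ⊥
SmallerBefore x (z ∷ w) = (z < x × x ∈ w) ⊎ SmallerBefore x w

-- w contains a subword x z x with z < x, i.e. violates the Stirling condition
NonStirling : List ℕ → Set
NonStirling [] = ⊥
NonStirling (x ∷ w) = NonStirling w ⊎ SmallerBefore x w

-- 0-based reading of a word, with the same junk value 0 as at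
nth : List ℕ → ℕ → ℕ
nth [] _ = 0
nth (x ∷ w) zero = x
nth (x ∷ w) (suc i) = nth w i

at-suc : ∀ σ i → at σ (suc i) ≡ nth σ i
at-suc [] i = refl
at-suc (x ∷ σ) zero = refl
at-suc (x ∷ σ) (suc i) = at-suc σ i

∈⇒nth : ∀ {x} w → x ∈ w → ∃ λ r → r < length w × nth w r ≡ x
∈⇒nth (y ∷ w) (here refl) = 0 , s≤s z≤n , refl
∈⇒nth (y ∷ w) (there x∈) with ∈⇒nth w x∈
... | r , r<len , wᵣ≡x = suc r , s≤s r<len , wᵣ≡x

nth-∈ : ∀ w {r} → r < length w → nth w r ∈ w
nth-∈ (y ∷ w) {zero} _ = here refl
nth-∈ (y ∷ w) {suc r} (s≤s r<len) = there (nth-∈ w r<len)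

record SmallerBeforeAt (x : ℕ) (w : List ℕ) : Set where
  constructor smallerBeforeAt
  field
    q r : ℕ
    q<r : q < r
    r<len : r < length w
    w_q<x : nth w q < x
    w_r≡x : nth w r ≡ x

record NonStirlingAt (w : List ℕ) : Set where
  constructor nonStirlingAt
  field
    p q r : ℕ
    p<q : p < q
    q<r : q < r
    r<len : r < length w
    w_p≡w_r : nth w p ≡ nth w r
    w_q<w_p : nth w q < nth w p

smallerBefore⇒At : ∀ x w → SmallerBefore x w → SmallerBeforeAt x w
smallerBefore⇒At x (z ∷ w) (inj₁ (z<x , x∈)) with ∈⇒nth w x∈
... | r , r<len , wᵣ≡x = smallerBeforeAt 0 (suc r) (s≤s z≤n) (s≤s r<len) z<x wᵣ≡x
smallerBefore⇒At x (z ∷ w) (inj₂ sb) with smallerBefore⇒At x w sb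
... | smallerBeforeAt q r q<r r<len lt eq = smallerBeforeAt (suc q) (suc r) (s≤s q<r) (s≤s r<len) lt eq

At⇒smallerBefore : ∀ x w → SmallerBeforeAt x w → SmallerBefore x w
At⇒smallerBefore x (z ∷ w) (smallerBeforeAt zero (suc r) _ (s≤s r<len) lt eq) =
  inj₁ (lt , subst (_∈ w) eq (nth-∈ w r<len))
At⇒smallerBefore x (z ∷ w) (smallerBeforeAt (suc q) (suc r) (s≤s q<r) (s≤s r<len) lt eq) =
  inj₂ (At⇒smallerBefore x w (smallerBeforeAt q r q<r r<len lt eq))

nonStirling⇒At : ∀ w → NonStirling w → NonStirlingAt w
nonStirling⇒At (x ∷ w) (inj₁ ns) with nonStirling⇒At w ns
... | nonStirlingAt p q r p<q q<r r<len eq lt =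
  nonStirlingAt (suc p) (suc q) (suc r) (s≤s p<q) (s≤s q<r) (s≤s r<len) eq lt
nonStirling⇒At (x ∷ w) (inj₂ sb) with smallerBefore⇒At x w sb
... | smallerBeforeAt q r q<r r<len lt eq =
  nonStirlingAt 0 (suc q) (suc r) (s≤s z≤n) (s≤s q<r) (s≤s r<len) (sym eq) lt

At⇒nonStirling : ∀ w → NonStirlingAt w → NonStirling w
At⇒nonStirling (x ∷ w) (nonStirlingAt zero (suc q) (suc r) _ (s≤s q<r) (s≤s r<len) eq lt) =
  inj₂ (At⇒smallerBefore x w (smallerBeforeAt q r q<r r<len lt (sym eq)))
At⇒nonStirling (x ∷ w) (nonStirlingAt (suc p) (suc q) (suc r) (s≤s p<q) (s≤s q<r) (s≤s r<len) eq lt) =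
  inj₁ (At⇒nonStirling w (nonStirlingAt p q r p<q q<r r<len eq lt))

isStirling⇒¬NonStirling : ∀ σ → isStirling σ ≡ true → ¬ NonStirling σ
isStirling⇒¬NonStirling σ h ns with nonStirling⇒At σ ns
... | nonStirlingAt p q r p<q q<r r<len eq lt =
  ℕₚ.<⇒≱ σq<σp (invert-true (_ ℕ.≤? _) σp≤σq)
  where
  len = length σ
  σq<σp : at σ (suc q) < at σ (suc p)
  σq<σp = subst₂ _<_ (sym (at-suc σ q)) (sym (at-suc σ p)) lt
  forP = allᵇ⁻ _ (range 1 (suc len)) h
    (∈-range⁺ {1} {suc len} {suc p} (s≤s z≤n) (s≤s (ℕₚ.<-trans p<q (ℕₚ.<-trans q<r r<len))))
  forR = allᵇ⁻ _ (range (suc (suc p)) (suc len)) forP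
    (∈-range⁺ {suc (suc p)} {suc len} {suc r} (s≤s (ℕₚ.<-trans p<q q<r)) (s≤s r<len))
  σp≡σr : (at σ (suc p) ≡ᵇ at σ (suc r)) ≡ true
  σp≡σr = dec-true (_ ℕ.≟ _) (trans (at-suc σ p) (trans eq (sym (at-suc σ r))))
  between : allᵇ (λ q → at σ (suc p) ≤ᵇ at σ q) (range (suc (suc p)) (suc r)) ≡ true
  between = subst (λ b → (if b then allᵇ (λ q → at σ (suc p) ≤ᵇ at σ q) (range (suc (suc p)) (suc r)) else true) ≡ true)
                  σp≡σr forR
  σp≤σq = allᵇ⁻ _ (range (suc (suc p)) (suc r)) between (∈-range⁺ {suc (suc p)} {suc r} {suc q} (s≤s p<q) (s≤s q<r))

¬NonStirling⇒isStirling : ∀ σ → ¬ NonStirling σ → isStirling σ ≡ true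
¬NonStirling⇒isStirling σ ns with isStirling σ in hs
... | true = refl
... | false = ⊥-elim (ns (At⇒nonStirling σ violation))
  where
  len = length σ
  violation : NonStirlingAt σ
  violation with allᵇ-false⁻ _ (range 1 (suc len)) hs
  ... | zero , p∈ , _ with () ← proj₁ (∈-range⁻ {1} {suc len} p∈)
  ... | suc p , p∈ , hp with allᵇ-false⁻ _ (range (suc (suc p)) (suc len)) hp
  ...   | zero , r∈ , _ with () ← proj₁ (∈-range⁻ {suc (suc p)} {suc len} r∈)
  ...   | suc r , r∈ , hr with ∈-range⁻ {suc (suc p)} {suc len} r∈ | at σ (suc p) ≡ᵇ at σ (suc r) in he
  ...     | (_ , s≤s r<len) | true with allᵇ-false⁻ _ (range (suc (suc p)) (suc r)) hr
  ...       | zero , q∈ , _ with () ← proj₁ (∈-range⁻ {suc (suc p)} {suc r} q∈)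
  ...       | suc q , q∈ , hq with ∈-range⁻ {suc (suc p)} {suc r} q∈
  ...         | (p<q , q<r) = nonStirlingAt p q r (ℕₚ.≤-pred p<q) (ℕₚ.≤-pred q<r) r<len
          (trans (sym (at-suc σ p)) (trans (invert-true (_ ℕ.≟ _) he) (at-suc σ r)))
          (subst₂ _<_ (at-suc σ q) (at-suc σ p) (ℕₚ.≰⇒> (invert-false (_ ℕ.≤? _) hq)))

module _ {a b} {A : Set a} {B : Set b} where

  Unique-concatMap⁺ : (f : A → List B) (key : B → A) {xs : List A} → Unique xs →
    (∀ {x} → x ∈ xs → Unique (f x)) → (∀ {x y} → x ∈ xs → y ∈ f x → key y ≡ x) →
    Unique (concatMap f xs)
  Unique-concatMap⁺ f key {[]} u uf k = []
  Unique-concatMap⁺ f key {x ∷ xs} (x∉xs ∷ u) uf k =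
    Uniqueₚ.++⁺ (uf (here refl)) (Unique-concatMap⁺ f key u (uf ∘ there) (k ∘ there)) disjoint
    where
    disjoint : ∀ {v} → ¬ (v ∈ f x × v ∈ concatMap f xs)
    disjoint (v∈fx , v∈rest) with find (∈-concatMap⁻ f {xs = xs} v∈rest)
    ... | x′ , x′∈xs , v∈fx′ = All.lookup x∉xs x′∈xs (trans (sym (k (here refl) v∈fx)) (k (there x′∈xs) v∈fx′))

  Unique-map⁺ : (f : A → B) {xs : List A} → Unique xs →
    (∀ {x y} → x ∈ xs → y ∈ xs → f x ≡ f y → x ≡ y) → Unique (map f xs)
  Unique-map⁺ f {[]} u inj = []
  Unique-map⁺ f {x ∷ xs} (x∉xs ∷ u) inj =
    Allₚ.map⁺ (All.tabulate λ y∈ fx≡fy → All.lookup x∉xs y∈ (inj (here refl) (there y∈) fx≡fy))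
    ∷ Unique-map⁺ f u (λ x∈ y∈ → inj (there x∈) (there y∈))

unique-↭ : ∀ {a} {A : Set a} {xs ys : List A} → Unique xs → Unique ys →
  (∀ {z} → z ∈ xs → z ∈ ys) → (∀ {z} → z ∈ ys → z ∈ xs) → xs ↭ ys
unique-↭ ux uy f g = ∼bag⇒↭ (unique∧set⇒bag ux uy (mk⇔ f g))

Letter : ℕ → ℕ → Set
Letter n x = 1 ≤ x × x ≤ n

∈-words⁺ : ∀ n len (w : List ℕ) → length w ≡ len → All (Letter n) w → w ∈ words n len
∈-words⁺ n zero [] refl [] = here refl
∈-words⁺ n (suc len) (suc a ∷ w) refl ((s≤s z≤n , s≤s a<n) ∷ letters) =
  ∈-concatMap⁺ (λ w → map (λ a → suc a ∷ w) (upTo n))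
    (Any.map (λ { refl → ∈-map⁺ _ (∈-upTo⁺ (s≤s a<n)) }) (∈-words⁺ n len w refl letters))

∈-words⁻ : ∀ n len (w : List ℕ) → w ∈ words n len → length w ≡ len × All (Letter n) w
∈-words⁻ n zero w (here refl) = refl , []
∈-words⁻ n (suc len) w w∈ with find (∈-concatMap⁻ (λ w → map (λ a → suc a ∷ w) (upTo n)) {xs = words n len} w∈)
... | w′ , w′∈ , w∈′ with ∈-map⁻ _ w∈′
... | a , a∈ , refl with ∈-words⁻ n len w′ w′∈
... | len≡ , letters = cong suc len≡ , (s≤s z≤n , ∈-upTo⁻ a∈) ∷ letters

words-unique : ∀ n len → Unique (words n len)
words-unique n zero = [] ∷ []
words-unique n (suc len) = Unique-concatMap⁺ _ (drop 1) (words-unique n len)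
  (λ _ → Uniqueₚ.map⁺ (λ { refl → refl }) (Uniqueₚ.upTo⁺ n))
  (λ _ y∈ → tail-≡ (∈-map⁻ _ y∈))
  where
  tail-≡ : ∀ {w y} → ∃ (λ a → a ∈ upTo n × y ≡ suc a ∷ w) → drop 1 y ≡ w
  tail-≡ (a , _ , refl) = refl

occ : ℕ → List ℕ → ℕ
occ v xs = countᵇ (λ x → x ≡ᵇ v) xs

occ-∷ : ∀ v x xs → occ v (x ∷ xs) ≡ ⟦ x ≡ᵇ v ⟧ + occ v xs
occ-∷ v x xs = countᵇ-∷ (λ y → y ≡ᵇ v) x xs

record IsStirlingPerm (k n : ℕ) (σ : List ℕ) : Set where
  constructor isStirlingPerm
  field
    length≡ : length σ ≡ k * n
    letters : All (Letter n) σ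
    occurrences : ∀ i → 1 ≤ i → i ≤ n → occ i σ ≡ k
    stirling : ¬ NonStirling σ

∈𝒬⇒IsStirlingPerm : ∀ {k n σ} → σ ∈ 𝒬 n k → IsStirlingPerm k n σ
∈𝒬⇒IsStirlingPerm {k} {n} {σ} σ∈
  with ∈-filter⁻ (λ σ → Bool._≟_ (isMultisetPerm k n σ ∧ isStirling σ) true) {xs = words n (k * n)} σ∈
... | σ∈words , h with ∈-words⁻ n (k * n) σ σ∈words | ∧-true {isMultisetPerm k n σ} h
... | (len≡ , letters) | (multiset , stirling) = isStirlingPerm len≡ letters
  (λ i 1≤i i≤n → invert-true (_ ℕ.≟ _) (allᵇ⁻ _ (range 1 (suc n)) multiset (∈-range⁺ 1≤i (s≤s i≤n))))
  (isStirling⇒¬NonStirling σ stirling)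

IsStirlingPerm⇒∈𝒬 : ∀ {k n σ} → IsStirlingPerm k n σ → σ ∈ 𝒬 n k
IsStirlingPerm⇒∈𝒬 {k} {n} {σ} (isStirlingPerm len≡ letters occurrences stirling) =
  ∈-filter⁺ (λ σ → Bool._≟_ (isMultisetPerm k n σ ∧ isStirling σ) true) {xs = words n (k * n)}
    (∈-words⁺ n (k * n) σ len≡ letters)
    (subst₂ (λ x y → x ∧ y ≡ true) (sym multiset) (sym (¬NonStirling⇒isStirling σ stirling)) refl)
  where
  multiset : isMultisetPerm k n σ ≡ true
  multiset = allᵇ⁺ _ (range 1 (suc n)) λ {i} i∈ →
    let (1≤i , i<1+n) = ∈-range⁻ {1} {suc n} i∈ in dec-true (_ ℕ.≟ _) (occurrences i 1≤i (ℕₚ.≤-pred i<1+n))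

𝒬-unique : ∀ n k → Unique (𝒬 n k)
𝒬-unique n k = Uniqueₚ.filter⁺ _ (words-unique n (k * n))

-- Inserting the block of largest letters

occ-++ : ∀ v (a b : List ℕ) → occ v (a ++ b) ≡ occ v a + occ v b
occ-++ v [] b = refl
occ-++ v (x ∷ a) b = begin
  occ v (x ∷ a ++ b)                   ≡⟨ occ-∷ v x (a ++ b) ⟩
  ⟦ x ≡ᵇ v ⟧ + occ v (a ++ b)          ≡⟨ cong (⟦ x ≡ᵇ v ⟧ +_) (occ-++ v a b) ⟩
  ⟦ x ≡ᵇ v ⟧ + (occ v a + occ v b)     ≡⟨ ℕₚ.+-assoc ⟦ x ≡ᵇ v ⟧ _ _ ⟨
  (⟦ x ≡ᵇ v ⟧ + occ v a) + occ v b     ≡⟨ cong (_+ occ v b) (occ-∷ v x a) ⟨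
  occ v (x ∷ a) + occ v b              ∎
  where open ≡-Reasoning

occ-∉ : ∀ v xs → All (_≢ v) xs → occ v xs ≡ 0
occ-∉ v [] _ = refl
occ-∉ v (x ∷ xs) (x≢v ∷ xs≢v) rewrite occ-∷ v x xs | ≢⇒≡ᵇ-false x≢v = occ-∉ v xs xs≢v

occ>0⇒∈ : ∀ v w → 1 ≤ occ v w → v ∈ w
occ>0⇒∈ v (y ∷ w) h rewrite occ-∷ v y w with y ≡ᵇ v in y≡ᵇv
... | true = here (sym (invert-true (y ℕ.≟ v) y≡ᵇv))
... | false = there (occ>0⇒∈ v w h)

<⇒≢ : ∀ {N x} → x < N → x ≢ N
<⇒≢ x<N refl = ℕₚ.<-irrefl refl x<N

∈-replicate⁻ : ∀ {N x : ℕ} j → x ∈ replicate j N → x ≡ N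
∈-replicate⁻ (suc j) (here refl) = refl
∈-replicate⁻ (suc j) (there x∈) = ∈-replicate⁻ j x∈

erase : ℕ → List ℕ → List ℕ
erase N [] = []
erase N (x ∷ w) = if x ≡ᵇ N then erase N w else x ∷ erase N w

insertBlock : ℕ → ℕ → ℕ → List ℕ → List ℕ
insertBlock k N zero σ = replicate k N ++ σ
insertBlock k N (suc p) [] = replicate k N
insertBlock k N (suc p) (x ∷ σ) = x ∷ insertBlock k N p σ

module _ (k N : ℕ) where

  length-insertBlock : ∀ p σ → length (insertBlock k N p σ) ≡ k + length σ
  length-insertBlock zero σ = trans (Listₚ.length-++ (replicate k N)) (cong (_+ length σ) (Listₚ.length-replicate k))
  length-insertBlock (suc p) [] = trans (Listₚ.length-replicate k) (sym (ℕₚ.+-identityʳ k))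
  length-insertBlock (suc p) (x ∷ σ) = trans (cong suc (length-insertBlock p σ)) (sym (ℕₚ.+-suc k (length σ)))

  occ-insertBlock : ∀ v p σ → occ v (insertBlock k N p σ) ≡ occ v (replicate k N) + occ v σ
  occ-insertBlock v zero σ = occ-++ v (replicate k N) σ
  occ-insertBlock v (suc p) [] = sym (ℕₚ.+-identityʳ _)
  occ-insertBlock v (suc p) (x ∷ σ) = begin
    occ v (x ∷ insertBlock k N p σ)        ≡⟨ occ-∷ v x _ ⟩
    ⟦ x ≡ᵇ v ⟧ + occ v (insertBlock k N p σ) ≡⟨ cong (⟦ x ≡ᵇ v ⟧ +_) (occ-insertBlock v p σ) ⟩
    ⟦ x ≡ᵇ v ⟧ + (R + occ v σ)             ≡⟨ ℕ+.x∙yz≈y∙xz ⟦ x ≡ᵇ v ⟧ R _ ⟩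
    R + (⟦ x ≡ᵇ v ⟧ + occ v σ)             ≡⟨ cong (R +_) (occ-∷ v x σ) ⟨
    R + occ v (x ∷ σ)                      ∎
    where
    open ≡-Reasoning
    R = occ v (replicate k N)

  occ-replicate : ∀ j → occ N (replicate j N) ≡ j
  occ-replicate zero = refl
  occ-replicate (suc j) rewrite occ-∷ N N (replicate j N) | ≡ᵇ-refl N = cong suc (occ-replicate j)

  ∈-insertBlock⁻ : ∀ {x} p σ → x ∈ insertBlock k N p σ → x ≡ N ⊎ x ∈ σ
  ∈-insertBlock⁻ zero σ x∈ with ∈-++⁻ (replicate k N) x∈
  ... | inj₁ x∈block = inj₁ (∈-replicate⁻ k x∈block)
  ... | inj₂ x∈σ = inj₂ x∈σ
  ∈-insertBlock⁻ (suc p) [] x∈ = inj₁ (∈-replicate⁻ k x∈)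
  ∈-insertBlock⁻ (suc p) (y ∷ σ) (here refl) = inj₂ (here refl)
  ∈-insertBlock⁻ (suc p) (y ∷ σ) (there x∈) with ∈-insertBlock⁻ p σ x∈
  ... | inj₁ x≡N = inj₁ x≡N
  ... | inj₂ x∈σ = inj₂ (there x∈σ)

  ∈-insertBlock⁺ : ∀ {x} p σ → x ∈ σ → x ∈ insertBlock k N p σ
  ∈-insertBlock⁺ zero σ x∈ = ∈-++⁺ʳ (replicate k N) x∈
  ∈-insertBlock⁺ (suc p) (y ∷ σ) (here refl) = here refl
  ∈-insertBlock⁺ (suc p) (y ∷ σ) (there x∈) = there (∈-insertBlock⁺ p σ x∈)

  All-insertBlock⁺ : ∀ {P : ℕ → Set} p σ → All P σ → P N → All P (insertBlock k N p σ)
  All-insertBlock⁺ zero σ a pN = Allₚ.++⁺ (Allₚ.replicate⁺ k pN) a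
  All-insertBlock⁺ (suc p) [] a pN = Allₚ.replicate⁺ k pN
  All-insertBlock⁺ (suc p) (x ∷ σ) (px ∷ a) pN = px ∷ All-insertBlock⁺ p σ a pN

  insertBlock-length : ∀ (a c : List ℕ) → insertBlock k N (length a) (a ++ c) ≡ a ++ replicate k N ++ c
  insertBlock-length [] c = refl
  insertBlock-length (x ∷ a) c = cong (x ∷_) (insertBlock-length a c)

  erase-< : ∀ {σ} → All (_< N) σ → erase N σ ≡ σ
  erase-< [] = refl
  erase-< {y ∷ σ} (y<N ∷ σ<N) rewrite dec-false (y ℕ.≟ N) (<⇒≢ y<N) = cong (y ∷_) (erase-< σ<N)

  erase-replicate : ∀ j σ → erase N (replicate j N ++ σ) ≡ erase N σ
  erase-replicate zero σ = refl
  erase-replicate (suc j) σ rewrite ≡ᵇ-refl N = erase-replicate j σ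

  erase-insertBlock : ∀ p σ → All (_< N) σ → erase N (insertBlock k N p σ) ≡ σ
  erase-insertBlock zero σ σ<N = trans (erase-replicate k σ) (erase-< σ<N)
  erase-insertBlock (suc p) [] _ = trans (cong (erase N) (sym (Listₚ.++-identityʳ (replicate k N)))) (erase-replicate k [])
  erase-insertBlock (suc p) (y ∷ σ) (y<N ∷ σ<N) rewrite dec-false (y ℕ.≟ N) (<⇒≢ y<N) =
    cong (y ∷_) (erase-insertBlock p σ σ<N)

  SmallerBefore-++⁺ : ∀ {x} (a : List ℕ) {b} → SmallerBefore x b → SmallerBefore x (a ++ b)
  SmallerBefore-++⁺ [] sb = sb
  SmallerBefore-++⁺ (y ∷ a) sb = inj₂ (SmallerBefore-++⁺ a sb)

  NonStirling-++⁺ : ∀ (a : List ℕ) {b} → NonStirling b → NonStirling (a ++ b)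
  NonStirling-++⁺ [] ns = ns
  NonStirling-++⁺ (y ∷ a) ns = inj₁ (NonStirling-++⁺ a ns)

  SmallerBefore-insertBlock⁺ : ∀ {x} p σ → SmallerBefore x σ → SmallerBefore x (insertBlock k N p σ)
  SmallerBefore-insertBlock⁺ zero σ sb = SmallerBefore-++⁺ (replicate k N) sb
  SmallerBefore-insertBlock⁺ (suc p) (y ∷ σ) (inj₁ (y<x , x∈)) = inj₁ (y<x , ∈-insertBlock⁺ p σ x∈)
  SmallerBefore-insertBlock⁺ (suc p) (y ∷ σ) (inj₂ sb) = inj₂ (SmallerBefore-insertBlock⁺ p σ sb)

  NonStirling-insertBlock⁺ : ∀ p σ → NonStirling σ → NonStirling (insertBlock k N p σ)
  NonStirling-insertBlock⁺ zero σ ns = NonStirling-++⁺ (replicate k N) ns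
  NonStirling-insertBlock⁺ (suc p) (y ∷ σ) (inj₁ ns) = inj₁ (NonStirling-insertBlock⁺ p σ ns)
  NonStirling-insertBlock⁺ (suc p) (y ∷ σ) (inj₂ sb) = inj₂ (SmallerBefore-insertBlock⁺ p σ sb)

  SmallerBefore-replicate⁻ : ∀ {x} j {σ} → x < N → SmallerBefore x (replicate j N ++ σ) → SmallerBefore x σ
  SmallerBefore-replicate⁻ zero x<N sb = sb
  SmallerBefore-replicate⁻ (suc j) x<N (inj₁ (N<x , _)) = ⊥-elim (ℕₚ.<-asym x<N N<x)
  SmallerBefore-replicate⁻ (suc j) x<N (inj₂ sb) = SmallerBefore-replicate⁻ j x<N sb

  ¬SmallerBefore-max : ∀ j {σ} → All (_< N) σ → ¬ SmallerBefore N (replicate j N ++ σ)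
  ¬SmallerBefore-max zero (_ ∷ σ<N) (inj₁ (_ , N∈σ)) = ℕₚ.<-irrefl refl (All.lookup σ<N N∈σ)
  ¬SmallerBefore-max zero (_ ∷ σ<N) (inj₂ sb) = ¬SmallerBefore-max zero σ<N sb
  ¬SmallerBefore-max (suc j) σ<N (inj₁ (N<N , _)) = ℕₚ.<-irrefl refl N<N
  ¬SmallerBefore-max (suc j) σ<N (inj₂ sb) = ¬SmallerBefore-max j σ<N sb

  NonStirling-replicate⁻ : ∀ j {σ} → All (_< N) σ → NonStirling (replicate j N ++ σ) → NonStirling σ
  NonStirling-replicate⁻ zero σ<N ns = ns
  NonStirling-replicate⁻ (suc j) σ<N (inj₁ ns) = NonStirling-replicate⁻ j σ<N ns
  NonStirling-replicate⁻ (suc j) σ<N (inj₂ sb) = ⊥-elim (¬SmallerBefore-max j σ<N sb)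

  SmallerBefore-insertBlock⁻ : ∀ {x} p σ → x < N → SmallerBefore x (insertBlock k N p σ) → SmallerBefore x σ
  SmallerBefore-insertBlock⁻ zero σ x<N sb = SmallerBefore-replicate⁻ k x<N sb
  SmallerBefore-insertBlock⁻ (suc p) [] x<N sb =
    SmallerBefore-replicate⁻ k {[]} x<N (subst (SmallerBefore _) (sym (Listₚ.++-identityʳ (replicate k N))) sb)
  SmallerBefore-insertBlock⁻ (suc p) (y ∷ σ) x<N (inj₁ (y<x , x∈)) with ∈-insertBlock⁻ p σ x∈
  ... | inj₁ refl = ⊥-elim (ℕₚ.<-irrefl refl x<N)
  ... | inj₂ x∈σ = inj₁ (y<x , x∈σ)
  SmallerBefore-insertBlock⁻ (suc p) (y ∷ σ) x<N (inj₂ sb) = inj₂ (SmallerBefore-insertBlock⁻ p σ x<N sb)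

  NonStirling-insertBlock⁻ : ∀ p σ → All (_< N) σ → NonStirling (insertBlock k N p σ) → NonStirling σ
  NonStirling-insertBlock⁻ zero σ σ<N ns = NonStirling-replicate⁻ k σ<N ns
  NonStirling-insertBlock⁻ (suc p) [] _ ns =
    NonStirling-replicate⁻ k {[]} [] (subst NonStirling (sym (Listₚ.++-identityʳ (replicate k N))) ns)
  NonStirling-insertBlock⁻ (suc p) (y ∷ σ) (_ ∷ σ<N) (inj₁ ns) = inj₁ (NonStirling-insertBlock⁻ p σ σ<N ns)
  NonStirling-insertBlock⁻ (suc p) (y ∷ σ) (y<N ∷ σ<N) (inj₂ sb) = inj₂ (SmallerBefore-insertBlock⁻ p σ y<N sb)

insertBlock-injective : ∀ k N {p p′} σ → All (_< N) σ → p ≤ length σ → p′ ≤ length σ →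
  insertBlock (suc k) N p σ ≡ insertBlock (suc k) N p′ σ → p ≡ p′
insertBlock-injective k N {zero} {zero} σ _ _ _ _ = refl
insertBlock-injective k N {zero} {suc p′} (y ∷ σ) (y<N ∷ _) _ _ eq = ⊥-elim (<⇒≢ y<N (sym (Listₚ.∷-injectiveˡ eq)))
insertBlock-injective k N {suc p} {zero} (y ∷ σ) (y<N ∷ _) _ _ eq = ⊥-elim (<⇒≢ y<N (Listₚ.∷-injectiveˡ eq))
insertBlock-injective k N {suc p} {suc p′} (y ∷ σ) (_ ∷ σ<N) (s≤s p≤) (s≤s p′≤) eq =
  cong suc (insertBlock-injective k N σ σ<N p≤ p′≤ (Listₚ.∷-injectiveʳ eq))

module _ (N : ℕ) where

  split-first : ∀ w → All (_≤ N) w → N ∈ w → ∃₂ λ a b → w ≡ a ++ N ∷ b × All (_< N) a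
  split-first (y ∷ w) (y≤N ∷ w≤N) N∈ with y ℕ.≟ N
  ... | yes refl = [] , w , refl , []
  ... | no y≢N with N∈
  ...   | here refl = ⊥-elim (y≢N refl)
  ...   | there N∈w with split-first w w≤N N∈w
  ...     | a , b , refl , a<N = y ∷ a , b , refl , ℕₚ.≤∧≢⇒< y≤N y≢N ∷ a<N

  split-run : ∀ b → All (_≤ N) b → ¬ SmallerBefore N b → ∃₂ λ j c → b ≡ replicate j N ++ c × All (_< N) c
  split-run [] _ _ = 0 , [] , refl , []
  split-run (y ∷ b) (y≤N ∷ b≤N) ¬sb with y ℕ.≟ N
  ... | yes refl with split-run b b≤N (¬sb ∘ inj₂)
  ...   | j , c , refl , c<N = suc j , c , refl , c<N
  split-run (y ∷ b) (y≤N ∷ b≤N) ¬sb | no y≢N = 0 , y ∷ b , refl , (y<N ∷ All.tabulate b<N)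
    where
    y<N = ℕₚ.≤∧≢⇒< y≤N y≢N
    b<N : ∀ {z} → z ∈ b → z < N
    b<N {z} z∈ with z ℕ.≟ N
    ... | yes refl = ⊥-elim (¬sb (inj₁ (y<N , z∈)))
    ... | no z≢N = ℕₚ.≤∧≢⇒< (All.lookup b≤N z∈) z≢N

  block-decomposition : ∀ k w → All (_≤ N) w → ¬ NonStirling w → occ N w ≡ suc k →
    ∃₂ λ a c → w ≡ a ++ replicate (suc k) N ++ c × All (_< N) a × All (_< N) c
  block-decomposition k w w≤N ¬ns occN with split-first w w≤N (occ>0⇒∈ N w (subst (1 ≤_) (sym occN) (s≤s z≤n)))
  ... | a , b , refl , a<N with split-run b (All.tail (proj₂ (Allₚ.++⁻ a w≤N))) (¬ns ∘ NonStirling-++⁺ 0 N a ∘ inj₂)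
  ... | j , c , refl , c<N = a , c , cong (λ i → a ++ N ∷ replicate i N ++ c) j≡k , a<N , c<N
    where
    open ≡-Reasoning
    absent : ∀ {xs} → All (_< N) xs → occ N xs ≡ 0
    absent xs<N = occ-∉ N _ (All.map <⇒≢ xs<N)
    j≡k : j ≡ k
    j≡k = ℕₚ.suc-injective (begin
      suc j                                          ≡⟨ cong suc (occ-replicate 0 N j) ⟨
      suc (occ N (replicate j N))                    ≡⟨ cong suc (ℕₚ.+-identityʳ _) ⟨
      suc (occ N (replicate j N) + 0)                ≡⟨ cong (λ z → suc (occ N (replicate j N) + z)) (absent c<N) ⟨
      suc (occ N (replicate j N) + occ N c)          ≡⟨ cong suc (occ-++ N (replicate j N) c) ⟨
      suc (occ N (replicate j N ++ c))               ≡⟨ cong (λ b → ⟦ b ⟧ + occ N (replicate j N ++ c)) (≡ᵇ-refl N) ⟨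
      ⟦ N ≡ᵇ N ⟧ + occ N (replicate j N ++ c)        ≡⟨ occ-∷ N N _ ⟨
      occ N (N ∷ replicate j N ++ c)                 ≡⟨ cong (_+ occ N (N ∷ replicate j N ++ c)) (absent a<N) ⟨
      occ N a + occ N (N ∷ replicate j N ++ c)       ≡⟨ occ-++ N a _ ⟨
      occ N (a ++ N ∷ replicate j N ++ c)            ≡⟨ occN ⟩
      suc k                                          ∎)

insertions : ℕ → ℕ → List (List ℕ)
insertions k n = concatMap (λ σ → map (λ p → insertBlock k (suc n) p σ) (upTo (suc (k * n)))) (𝒬 n k)

Letter⇒< : ∀ {n x} → Letter n x → x < suc n
Letter⇒< (_ , x≤n) = s≤s x≤n

module _ (k′ n : ℕ) where
  private
    k = suc k′
    N = suc n

  IsStirlingPerm-insertBlock : ∀ σ p → IsStirlingPerm k n σ → IsStirlingPerm k N (insertBlock k N p σ)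
  IsStirlingPerm-insertBlock σ p (isStirlingPerm len≡ letters occurrences stirling) =
    isStirlingPerm length≡′ letters′ occurrences′ (stirling ∘ NonStirling-insertBlock⁻ k N p σ σ<N)
    where
    σ<N = All.map Letter⇒< letters
    length≡′ : length (insertBlock k N p σ) ≡ k * N
    length≡′ = trans (length-insertBlock k N p σ) (trans (cong (k +_) len≡) (sym (ℕₚ.*-suc k n)))
    letters′ = All-insertBlock⁺ k N p σ (All.map (λ (1≤x , x≤n) → 1≤x , ℕₚ.m≤n⇒m≤1+n x≤n) letters) (s≤s z≤n , ℕₚ.≤-refl)
    occurrences′ : ∀ i → 1 ≤ i → i ≤ N → occ i (insertBlock k N p σ) ≡ k
    occurrences′ i 1≤i i≤N with i ℕ.≟ N
    ... | yes refl = trans (occ-insertBlock k N N p σ)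
      (trans (cong₂ _+_ (occ-replicate k N k) (occ-∉ N σ (All.map <⇒≢ σ<N))) (ℕₚ.+-identityʳ k))
    ... | no i≢N = trans (occ-insertBlock k N i p σ)
      (trans (cong (_+ occ i σ) (occ-∉ i _ (Allₚ.replicate⁺ k (i≢N ∘ sym)))) (occurrences i 1≤i (ℕₚ.≤-pred (ℕₚ.≤∧≢⇒< i≤N i≢N))))

  IsStirlingPerm-removeBlock : ∀ w → IsStirlingPerm k N w →
    ∃₂ λ σ p → IsStirlingPerm k n σ × p ≤ k * n × w ≡ insertBlock k N p σ
  IsStirlingPerm-removeBlock w (isStirlingPerm len≡ letters occurrences stirling)
    with block-decomposition N k′ w (All.map proj₂ letters) stirling (occurrences N (s≤s z≤n) ℕₚ.≤-refl)
  ... | a , c , refl , a<N , c<N =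
    a ++ c , length a , isStirlingPerm length≡′ letters′ occurrences′ stirling′ , p≤ , sym w≡
    where
    σ = a ++ c
    w≡ : insertBlock k N (length a) σ ≡ a ++ replicate k N ++ c
    w≡ = insertBlock-length k N a c
    length≡′ : length σ ≡ k * n
    length≡′ = ℕₚ.+-cancelˡ-≡ k _ _ (trans (sym (length-insertBlock k N (length a) σ))
      (trans (cong length w≡) (trans len≡ (ℕₚ.*-suc k n))))
    lower-letter : ∀ {x} → Letter N x → x < N → Letter n x
    lower-letter (1≤x , _) (s≤s x≤n) = 1≤x , x≤n
    aw = Allₚ.++⁻ a letters
    letters′ : All (Letter n) σ
    letters′ = Allₚ.++⁺ (All.zipWith (λ (l , x<N) → lower-letter l x<N) (proj₁ aw , a<N))
                        (All.zipWith (λ (l , x<N) → lower-letter l x<N) (proj₂ (Allₚ.++⁻ (replicate k N) (proj₂ aw)) , c<N))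
    occurrences′ : ∀ i → 1 ≤ i → i ≤ n → occ i σ ≡ k
    occurrences′ i 1≤i i≤n = begin
      occ i σ                                   ≡⟨ cong (_+ occ i σ) (occ-∉ i _ (Allₚ.replicate⁺ k (<⇒≢ (s≤s i≤n) ∘ sym))) ⟨
      occ i (replicate k N) + occ i σ           ≡⟨ occ-insertBlock k N i (length a) σ ⟨
      occ i (insertBlock k N (length a) σ)      ≡⟨ cong (occ i) w≡ ⟩
      occ i (a ++ replicate k N ++ c)           ≡⟨ occurrences i 1≤i (ℕₚ.m≤n⇒m≤1+n i≤n) ⟩
      k                                         ∎
      where open ≡-Reasoning
    stirling′ : ¬ NonStirling σ
    stirling′ ns = stirling (subst NonStirling w≡ (NonStirling-insertBlock⁺ k N (length a) σ ns))
    p≤ : length a ≤ k * n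
    p≤ = subst (length a ≤_) (trans (sym (Listₚ.length-++ a)) length≡′) (ℕₚ.m≤m+n (length a) (length c))

  insertions-unique : Unique (insertions k n)
  insertions-unique = Unique-concatMap⁺ _ (erase N) (𝒬-unique n k)
    (λ {σ} σ∈ → Unique-map⁺ _ (Uniqueₚ.upTo⁺ (suc (k * n))) (λ p∈ p′∈ →
      let perm = ∈𝒬⇒IsStirlingPerm {k} σ∈
          ≤len = λ {p} p∈ → subst (p ≤_) (sym (IsStirlingPerm.length≡ perm)) (ℕₚ.≤-pred (∈-upTo⁻ p∈))
      in insertBlock-injective k′ N σ (All.map Letter⇒< (IsStirlingPerm.letters perm)) (≤len p∈) (≤len p′∈)))
    (λ σ∈ y∈ → erased σ∈ (∈-map⁻ _ y∈))
    where
    erased : ∀ {σ y} → σ ∈ 𝒬 n k → ∃ (λ p → p ∈ upTo (suc (k * n)) × y ≡ insertBlock k N p σ) → erase N y ≡ σ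
    erased σ∈ (p , _ , refl) = erase-insertBlock k N p _ (All.map Letter⇒< (IsStirlingPerm.letters (∈𝒬⇒IsStirlingPerm {k} σ∈)))

  𝒬-suc↭insertions : 𝒬 N k ↭ insertions k n
  𝒬-suc↭insertions = unique-↭ (𝒬-unique N k) insertions-unique ⊆ ⊇
    where
    ⊆ : ∀ {w} → w ∈ 𝒬 N k → w ∈ insertions k n
    ⊆ {w} w∈ with IsStirlingPerm-removeBlock w (∈𝒬⇒IsStirlingPerm {k} w∈)
    ... | σ , p , perm , p≤ , refl = ∈-concatMap⁺ (λ σ → map (λ p → insertBlock k N p σ) (upTo (suc (k * n))))
      (Any.map (λ { refl → ∈-map⁺ (λ p → insertBlock k N p σ) (∈-upTo⁺ (s≤s p≤)) }) (IsStirlingPerm⇒∈𝒬 perm))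
    ⊇ : ∀ {w} → w ∈ insertions k n → w ∈ 𝒬 N k
    ⊇ {w} w∈ with find (∈-concatMap⁻ (λ σ → map (λ p → insertBlock k N p σ) (upTo (suc (k * n)))) {xs = 𝒬 n k} w∈)
    ... | σ , σ∈ , w∈′ with ∈-map⁻ (λ p → insertBlock k N p σ) {xs = upTo (suc (k * n))} w∈′
    ... | p , _ , refl = IsStirlingPerm⇒∈𝒬 (IsStirlingPerm-insertBlock σ p (∈𝒬⇒IsStirlingPerm {k} σ∈))

-- Labels: the variable each index of σ contributes to the weight

-- An ascent is labelled k (variable x_{k+1}), a descent k - 1 (x_k), and a plateau of a letter
-- with c earlier occurrences c (x_{c+1}); the junk label k + 1 (a plateau with c ≥ k - 1)
-- never occurs in a Stirling permutation.
label : ℕ → ℕ → ℕ → ℕ → ℕ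
label k a b c = if a <ᵇ b then k else if b <ᵇ a then k ∸ 1 else if c <ᵇ k ∸ 1 then c else suc k

labelAt : ℕ → List ℕ → ℕ → ℕ
labelAt k σ i = label k (at σ i) (at σ (suc i)) (countᵇ (λ ℓ → at σ ℓ ≡ᵇ at σ i) (upTo i))

-- The labels of the indices of cur ∷ rest, where pre lists the letters before cur.
labelsFrom : ℕ → List ℕ → ℕ → List ℕ → List ℕ
labelsFrom k pre cur [] = label k cur 0 (occ cur pre) ∷ []
labelsFrom k pre cur (y ∷ ys) = label k cur y (occ cur pre) ∷ labelsFrom k (cur ∷ pre) y ys

labels : ℕ → List ℕ → List ℕ
labels k σ = labelsFrom k [] 0 σ

applyUpTo-cong : ∀ {f g : ℕ → ℕ} n → (∀ i → f i ≡ g i) → applyUpTo f n ≡ applyUpTo g n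
applyUpTo-cong zero h = refl
applyUpTo-cong (suc n) h = cong₂ _∷_ (h 0) (applyUpTo-cong n (h ∘ suc))

countᵇ-cong : ∀ {P Q : ℕ → Bool} xs → (∀ x → P x ≡ Q x) → countᵇ P xs ≡ countᵇ Q xs
countᵇ-cong {P} {Q} xs h = trans (countᵇ-∑ P xs) (trans (∑-cong xs (λ {x} _ → cong ⟦_⟧ (h x))) (sym (countᵇ-∑ Q xs)))

countᵇ-map : ∀ (P : ℕ → Bool) (f : ℕ → ℕ) xs → countᵇ P (map f xs) ≡ countᵇ (P ∘ f) xs
countᵇ-map P f xs = trans (countᵇ-∑ P (map f xs)) (trans (∑-map f xs (λ x → ⟦ P x ⟧)) (sym (countᵇ-∑ (P ∘ f) xs)))

countᵇ-upTo-suc : ∀ (P : ℕ → Bool) i → countᵇ P (upTo (suc i)) ≡ ⟦ P 0 ⟧ + countᵇ (P ∘ suc) (upTo i)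
countᵇ-upTo-suc P i = trans (countᵇ-∷ P 0 (applyUpTo suc i))
  (cong (⟦ P 0 ⟧ +_) (trans (cong (countᵇ P) (sym (Listₚ.map-upTo suc i))) (countᵇ-map P suc (upTo i))))

at≡nth : ∀ σ i → at σ i ≡ nth (0 ∷ σ) i
at≡nth σ zero = refl
at≡nth σ (suc i) = at-suc σ i

labelsFrom-applyUpTo : ∀ k pre cur rest →
  applyUpTo (λ i → label k (nth (cur ∷ rest) i) (nth (cur ∷ rest) (suc i))
     (occ (nth (cur ∷ rest) i) pre + countᵇ (λ ℓ → nth (cur ∷ rest) ℓ ≡ᵇ nth (cur ∷ rest) i) (upTo i)))
     (suc (length rest))
  ≡ labelsFrom k pre cur rest
labelsFrom-applyUpTo k pre cur [] = cong (λ z → label k cur 0 z ∷ []) (ℕₚ.+-identityʳ _)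
labelsFrom-applyUpTo k pre cur (y ∷ ys) = cong₂ _∷_ (cong (label k cur y) (ℕₚ.+-identityʳ _))
  (trans (applyUpTo-cong (suc (length ys)) shift) (labelsFrom-applyUpTo k (cur ∷ pre) y ys))
  where
  u = cur ∷ y ∷ ys
  shift : ∀ i → label k (nth u (suc i)) (nth u (suc (suc i)))
                  (occ (nth u (suc i)) pre + countᵇ (λ ℓ → nth u ℓ ≡ᵇ nth u (suc i)) (upTo (suc i)))
              ≡ label k (nth (y ∷ ys) i) (nth (y ∷ ys) (suc i))
                  (occ (nth (y ∷ ys) i) (cur ∷ pre) + countᵇ (λ ℓ → nth (y ∷ ys) ℓ ≡ᵇ nth (y ∷ ys) i) (upTo i))
  shift i = cong (label k v (nth (y ∷ ys) (suc i))) (begin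
      occ v pre + countᵇ (λ ℓ → nth u ℓ ≡ᵇ v) (upTo (suc i))
        ≡⟨ cong (occ v pre +_) (countᵇ-upTo-suc (λ ℓ → nth u ℓ ≡ᵇ v) i) ⟩
      occ v pre + (⟦ cur ≡ᵇ v ⟧ + X)   ≡⟨ ℕₚ.+-assoc (occ v pre) _ X ⟨
      (occ v pre + ⟦ cur ≡ᵇ v ⟧) + X   ≡⟨ cong (_+ X) (ℕₚ.+-comm (occ v pre) _) ⟩
      (⟦ cur ≡ᵇ v ⟧ + occ v pre) + X   ≡⟨ cong (_+ X) (occ-∷ v cur pre) ⟨
      occ v (cur ∷ pre) + X            ∎)
    where
    open ≡-Reasoning
    v = nth (y ∷ ys) i
    X = countᵇ (λ ℓ → nth (y ∷ ys) ℓ ≡ᵇ v) (upTo i)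

map-labelAt : ∀ k σ → map (labelAt k σ) (indices σ) ≡ labels k σ
map-labelAt k σ = trans (Listₚ.map-upTo (labelAt k σ) (suc (length σ)))
  (trans (applyUpTo-cong (suc (length σ)) viaNth) (labelsFrom-applyUpTo k [] 0 σ))
  where
  viaNth : ∀ i → labelAt k σ i ≡ label k (nth (0 ∷ σ) i) (nth (0 ∷ σ) (suc i))
     (occ (nth (0 ∷ σ) i) [] + countᵇ (λ ℓ → nth (0 ∷ σ) ℓ ≡ᵇ nth (0 ∷ σ) i) (upTo i))
  viaNth i rewrite at≡nth σ i | at≡nth σ (suc i) =
    cong (label k (nth (0 ∷ σ) i) (nth (0 ∷ σ) (suc i)))
         (countᵇ-cong (upTo i) (λ ℓ → cong (_≡ᵇ nth (0 ∷ σ) i) (at≡nth σ ℓ)))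

module _ (k′ : ℕ) where
  private
    k = suc k′

  label-< : ∀ {a b} c → a < b → label k a b c ≡ k
  label-< c a<b rewrite <⇒<ᵇ a<b = refl

  label-> : ∀ {a b} c → b < a → label k a b c ≡ k′
  label-> c b<a rewrite ≮⇒<ᵇ (ℕₚ.<⇒≯ b<a) | <⇒<ᵇ b<a = refl

  label-plateau : ∀ a {c} → c < k′ → label k a a c ≡ c
  label-plateau a c<k′ rewrite ≮⇒<ᵇ (ℕₚ.n≮n a) | <⇒<ᵇ c<k′ = refl

  label-junk : ∀ a {c} → ¬ c < k′ → label k a a c ≡ suc k
  label-junk a c≮k′ rewrite ≮⇒<ᵇ (ℕₚ.n≮n a) | ≮⇒<ᵇ c≮k′ = refl

  ascent-label : ∀ a b c → (a <ᵇ b) ≡ (label k a b c ≡ᵇ k)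
  ascent-label a b c with ℕₚ.<-cmp a b | c ℕ.<? k′
  ... | tri< a<b _ _ | _ rewrite label-< c a<b | <⇒<ᵇ a<b = sym (≡ᵇ-refl k)
  ... | tri> a≮b _ b<a | _ rewrite label-> c b<a | ≮⇒<ᵇ a≮b = sym (≢⇒≡ᵇ-false (ℕₚ.1+n≢n {k′} ∘ sym))
  ... | tri≈ a≮a refl _ | yes c<k′ rewrite label-plateau a c<k′ | ≮⇒<ᵇ a≮a =
    sym (≢⇒≡ᵇ-false (ℕₚ.<⇒≢ (ℕₚ.<-trans c<k′ (ℕₚ.n<1+n k′))))
  ... | tri≈ a≮a refl _ | no c≮k′ rewrite label-junk a c≮k′ | ≮⇒<ᵇ a≮a = sym (≢⇒≡ᵇ-false (ℕₚ.1+n≢n {k}))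

  descent-label : ∀ a b c → (b <ᵇ a) ≡ (label k a b c ≡ᵇ k′)
  descent-label a b c with ℕₚ.<-cmp a b | c ℕ.<? k′
  ... | tri< a<b _ b≮a | _ rewrite label-< c a<b | ≮⇒<ᵇ b≮a = sym (≢⇒≡ᵇ-false (ℕₚ.1+n≢n {k′}))
  ... | tri> _ _ b<a | _ rewrite label-> c b<a | <⇒<ᵇ b<a = sym (≡ᵇ-refl k′)
  ... | tri≈ a≮a refl _ | yes c<k′ rewrite label-plateau a c<k′ | ≮⇒<ᵇ a≮a = sym (≢⇒≡ᵇ-false (ℕₚ.<⇒≢ c<k′))
  ... | tri≈ a≮a refl _ | no c≮k′ rewrite label-junk a c≮k′ | ≮⇒<ᵇ a≮a =
    sym (≢⇒≡ᵇ-false (ℕₚ.<⇒≢ (ℕₚ.<-trans (ℕₚ.n<1+n k′) (ℕₚ.n<1+n k)) ∘ sym))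

  plateau-label : ∀ t a b c → t < k′ → ((a ≡ᵇ b) ∧ (c ≡ᵇ t)) ≡ (label k a b c ≡ᵇ t)
  plateau-label t a b c t<k′ with ℕₚ.<-cmp a b | c ℕ.<? k′
  ... | tri< a<b a≢b _ | _ rewrite label-< c a<b | ≢⇒≡ᵇ-false a≢b =
    sym (≢⇒≡ᵇ-false (ℕₚ.<⇒≢ (ℕₚ.<-trans t<k′ (ℕₚ.n<1+n k′)) ∘ sym))
  ... | tri> _ a≢b b<a | _ rewrite label-> c b<a | ≢⇒≡ᵇ-false a≢b = sym (≢⇒≡ᵇ-false (ℕₚ.<⇒≢ t<k′ ∘ sym))
  ... | tri≈ _ refl _ | yes c<k′ rewrite label-plateau a c<k′ | ≡ᵇ-refl a = refl
  ... | tri≈ _ refl _ | no c≮k′ rewrite label-junk a c≮k′ | ≡ᵇ-refl a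
                                      | ≢⇒≡ᵇ-false (λ c≡t → c≮k′ (subst (_< k′) (sym c≡t) t<k′)) =
    sym (≢⇒≡ᵇ-false (ℕₚ.<⇒≢ (ℕₚ.<-trans t<k′ (ℕₚ.<-trans (ℕₚ.n<1+n k′) (ℕₚ.n<1+n k))) ∘ sym))

  weight≡occ-labels : ∀ σ (t : Fin (suc k)) → lookup (weight k σ) t ≡ occ (toℕ t) (labels k σ)
  weight≡occ-labels σ t = begin
    lookup (weight k σ) t                                ≡⟨ Vecₚ.lookup∘tabulate entry t ⟩
    (if tn ≡ᵇ k then asc σ else if suc tn ≡ᵇ k then des σ else plat (suc tn) σ)
                                                         ≡⟨ byCase ⟩
    countᵇ (λ i → labelAt k σ i ≡ᵇ tn) (indices σ)       ≡⟨ countᵇ-map (_≡ᵇ tn) (labelAt k σ) (indices σ) ⟨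
    occ tn (map (labelAt k σ) (indices σ))               ≡⟨ cong (occ tn) (map-labelAt k σ) ⟩
    occ tn (labels k σ)                                  ∎
    where
    open ≡-Reasoning
    tn = toℕ t
    entry : Fin (suc k) → ℕ
    entry s = if toℕ s ≡ᵇ k then asc σ else if suc (toℕ s) ≡ᵇ k then des σ else plat (suc (toℕ s)) σ
    earlier : ℕ → ℕ
    earlier i = countᵇ (λ ℓ → at σ ℓ ≡ᵇ at σ i) (upTo i)
    byCase : (if tn ≡ᵇ k then asc σ else if suc tn ≡ᵇ k then des σ else plat (suc tn) σ)
             ≡ countᵇ (λ i → labelAt k σ i ≡ᵇ tn) (indices σ)
    byCase with tn ≡ᵇ k in tn≡ᵇk
    ... | true rewrite invert-true (tn ℕ.≟ k) tn≡ᵇk = countᵇ-cong (indices σ) (λ i → ascent-label (at σ i) (at σ (suc i)) (earlier i))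
    ... | false with suc tn ≡ᵇ k in 1+tn≡ᵇk
    ...   | true rewrite ℕₚ.suc-injective (invert-true (suc tn ℕ.≟ k) 1+tn≡ᵇk) = countᵇ-cong (indices σ) (λ i → descent-label (at σ i) (at σ (suc i)) (earlier i))
    ...   | false = countᵇ-cong (indices σ) (λ i → plateau-label tn (at σ i) (at σ (suc i)) (earlier i) tn<k′)
      where
      tn<k′ : tn < k′
      tn<k′ = ℕₚ.≤∧≢⇒< (ℕₚ.≤-pred (ℕₚ.≤∧≢⇒< (ℕₚ.≤-pred (Finₚ.toℕ<n t)) (invert-false (tn ℕ.≟ k) tn≡ᵇk)))
                       (invert-false (suc tn ℕ.≟ k) 1+tn≡ᵇk ∘ cong suc)

ascending : ℕ → ℕ → List ℕ
ascending c zero = []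
ascending c (suc j) = c ∷ ascending (suc c) j

-- The labels of a block N^k inserted into smaller letters: the ascent into it, its plateaux
-- 0, …, k - 2, and the descent out of it.
blockLabels : ℕ → List ℕ
blockLabels k′ = suc k′ ∷ (ascending 0 k′ ++ k′ ∷ [])

labelsAfter : ℕ → List ℕ → List ℕ → List ℕ
labelsAfter k pre [] = []
labelsAfter k pre (y ∷ ys) = labelsFrom k pre y ys

occ-∷-< : ∀ {N v} pre → v < N → occ v (N ∷ pre) ≡ occ v pre
occ-∷-< {N} {v} pre v<N rewrite occ-∷ v N pre | ≢⇒≡ᵇ-false (<⇒≢ v<N ∘ sym) = refl

module _ (k′ n : ℕ) where
  private
    k = suc k′
    N = suc n

  labelsFrom-cong : ∀ y ys p₁ p₂ → All (_< N) (y ∷ ys) → (∀ v → v < N → occ v p₁ ≡ occ v p₂) →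
    labelsFrom k p₁ y ys ≡ labelsFrom k p₂ y ys
  labelsFrom-cong y [] p₁ p₂ (y<N ∷ _) h = cong (λ z → label k y 0 z ∷ []) (h y y<N)
  labelsFrom-cong y (z ∷ zs) p₁ p₂ (y<N ∷ zs<N) h =
    cong₂ _∷_ (cong (label k y z) (h y y<N)) (labelsFrom-cong z zs (y ∷ p₁) (y ∷ p₂) zs<N h′)
    where
    h′ : ∀ v → v < N → occ v (y ∷ p₁) ≡ occ v (y ∷ p₂)
    h′ v v<N rewrite occ-∷ v y p₁ | occ-∷ v y p₂ = cong (⟦ y ≡ᵇ v ⟧ +_) (h v v<N)

  labelsFrom-run : ∀ j pre c pre₀ rest → occ N pre ≡ c → c + j ≡ k′ → All (_< N) rest →
    (∀ v → v < N → occ v pre ≡ occ v pre₀) →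
    labelsFrom k pre N (replicate j N ++ rest) ≡ ascending c j ++ k′ ∷ labelsAfter k pre₀ rest
  labelsFrom-run zero pre c pre₀ [] _ _ _ _ = cong (_∷ []) (label-> k′ {N} {0} (occ N pre) (s≤s z≤n))
  labelsFrom-run zero pre c pre₀ (y ∷ ys) _ _ rest<N h₀ =
    cong₂ _∷_ (label-> k′ (occ N pre) (All.head rest<N))
      (labelsFrom-cong y ys (N ∷ pre) pre₀ rest<N (λ v v<N → trans (occ-∷-< pre v<N) (h₀ v v<N)))
  labelsFrom-run (suc j) pre c pre₀ rest occN c+j rest<N h₀ =
    cong₂ _∷_ (trans (label-plateau k′ N (subst (_< k′) (sym occN) c<k′)) occN)
      (labelsFrom-run j (N ∷ pre) (suc c) pre₀ rest occN′ (trans (sym (ℕₚ.+-suc c j)) c+j) rest<N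
        (λ v v<N → trans (occ-∷-< pre v<N) (h₀ v v<N)))
    where
    c<k′ : c < k′
    c<k′ = subst (c <_) c+j (ℕₚ.≤-trans (s≤s (ℕₚ.m≤m+n c j)) (ℕₚ.≤-reflexive (sym (ℕₚ.+-suc c j))))
    occN′ : occ N (N ∷ pre) ≡ suc c
    occN′ rewrite occ-∷ N N pre | ≡ᵇ-refl N = cong suc occN

  drop-labelsFrom : ∀ pre cur rest → drop 1 (labelsFrom k pre cur rest) ≡ labelsAfter k (cur ∷ pre) rest
  drop-labelsFrom pre cur [] = refl
  drop-labelsFrom pre cur (y ∷ ys) = refl

  labelsFrom-insertBlock : ∀ p pre cur rest → p ≤ length rest → cur < N → All (_< N) pre → All (_< N) rest →
    labelsFrom k pre cur (insertBlock k N p rest)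
      ≡ take p (labelsFrom k pre cur rest) ++ blockLabels k′ ++ drop (suc p) (labelsFrom k pre cur rest)
  labelsFrom-insertBlock zero pre cur rest _ cur<N pre<N rest<N =
    cong₂ _∷_ (label-< k′ (occ cur pre) cur<N) (begin
      labelsFrom k (cur ∷ pre) N (replicate k′ N ++ rest)
        ≡⟨ labelsFrom-run k′ (cur ∷ pre) 0 (cur ∷ pre) rest (occ-∉ N _ (All.map <⇒≢ (cur<N ∷ pre<N))) refl rest<N (λ _ _ → refl) ⟩
      ascending 0 k′ ++ k′ ∷ labelsAfter k (cur ∷ pre) rest
        ≡⟨ cong (λ z → ascending 0 k′ ++ k′ ∷ z) (drop-labelsFrom pre cur rest) ⟨
      ascending 0 k′ ++ (k′ ∷ []) ++ drop 1 (labelsFrom k pre cur rest)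
        ≡⟨ Listₚ.++-assoc (ascending 0 k′) (k′ ∷ []) _ ⟨
      (ascending 0 k′ ++ k′ ∷ []) ++ drop 1 (labelsFrom k pre cur rest) ∎)
    where open ≡-Reasoning
  labelsFrom-insertBlock (suc p) pre cur (y ∷ ys) (s≤s p≤) cur<N pre<N (y<N ∷ ys<N) =
    cong (label k cur y (occ cur pre) ∷_) (labelsFrom-insertBlock p (cur ∷ pre) y ys p≤ y<N (cur<N ∷ pre<N) ys<N)

  labels-insertBlock : ∀ p σ → p ≤ length σ → All (_< N) σ →
    labels k (insertBlock k N p σ) ≡ take p (labels k σ) ++ blockLabels k′ ++ drop (suc p) (labels k σ)
  labels-insertBlock p σ p≤ σ<N = labelsFrom-insertBlock p [] 0 σ p≤ (s≤s z≤n) [] σ<N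

ascending-≥ : ∀ c j → All (c ≤_) (ascending c j ++ (c + j) ∷ [])
ascending-≥ c zero = ℕₚ.≤-reflexive (sym (ℕₚ.+-identityʳ c)) ∷ []
ascending-≥ c (suc j) = ℕₚ.≤-refl ∷ All.map (ℕₚ.≤-trans (ℕₚ.n≤1+n c))
  (subst (λ z → All (suc c ≤_) (ascending (suc c) j ++ z ∷ [])) (sym (ℕₚ.+-suc c j)) (ascending-≥ (suc c) j))

occ-ascending : ∀ c j t → c ≤ t → t ≤ c + j → occ t (ascending c j ++ (c + j) ∷ []) ≡ 1
occ-ascending c zero t c≤t t≤c+0
  rewrite ℕₚ.≤-antisym t≤c+0 (subst (_≤ t) (sym (ℕₚ.+-identityʳ c)) c≤t) | ≡ᵇ-refl (c + 0) = refl
occ-ascending c (suc j) t c≤t t≤ with c ℕ.≟ t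
... | yes refl rewrite occ-∷ c c (ascending (suc c) j ++ (c + suc j) ∷ []) | ≡ᵇ-refl c =
  cong suc (occ-∉ c _ (All.map (λ c<x → <⇒≢ c<x ∘ sym)
    (subst (λ z → All (suc c ≤_) (ascending (suc c) j ++ z ∷ [])) (sym (ℕₚ.+-suc c j)) (ascending-≥ (suc c) j))))
... | no c≢t rewrite occ-∷ t c (ascending (suc c) j ++ (c + suc j) ∷ []) | ≢⇒≡ᵇ-false c≢t | ℕₚ.+-suc c j =
  occ-ascending (suc c) j t (ℕₚ.≤∧≢⇒< c≤t c≢t) t≤

occ-blockLabels : ∀ k′ t → t ≤ suc k′ → occ t (blockLabels k′) ≡ 1
occ-blockLabels k′ t t≤ with suc k′ ℕ.≟ t
... | yes refl rewrite occ-∷ (suc k′) (suc k′) (ascending 0 k′ ++ k′ ∷ []) | ≡ᵇ-refl (suc k′) =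
  cong suc (occ-∉ (suc k′) _ (All.map (λ x≤k′ → <⇒≢ (s≤s x≤k′)) (≤k′ k′)))
  where
  ascending-< : ∀ c j {x} → x ∈ ascending c j → x < c + j
  ascending-< c (suc j) (here refl) = subst (c <_) (sym (ℕₚ.+-suc c j)) (s≤s (ℕₚ.m≤m+n c j))
  ascending-< c (suc j) {x} (there x∈) = subst (x <_) (sym (ℕₚ.+-suc c j)) (ascending-< (suc c) j x∈)
  ≤k′ : ∀ k′ → All (_≤ k′) (ascending 0 k′ ++ k′ ∷ [])
  ≤k′ k′ = Allₚ.++⁺ (All.tabulate (ℕₚ.<⇒≤ ∘ ascending-< 0 k′)) (ℕₚ.≤-refl ∷ [])
... | no ne rewrite occ-∷ t (suc k′) (ascending 0 k′ ++ k′ ∷ []) | ≢⇒≡ᵇ-false ne =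
  occ-ascending 0 k′ t z≤n (ℕₚ.≤-pred (ℕₚ.≤∧≢⇒< t≤ (ne ∘ sym)))

length-labelsFrom : ∀ k pre cur rest → length (labelsFrom k pre cur rest) ≡ suc (length rest)
length-labelsFrom k pre cur [] = refl
length-labelsFrom k pre cur (y ∷ ys) = cong suc (length-labelsFrom k (cur ∷ pre) y ys)

drop≡nth∷drop : ∀ (L : List ℕ) p → p < length L → drop p L ≡ nth L p ∷ drop (suc p) L
drop≡nth∷drop (x ∷ L) zero _ = refl
drop≡nth∷drop (x ∷ L) (suc p) (s≤s p<) = drop≡nth∷drop L p p<

occ-split : ∀ t (L : List ℕ) p → p < length L →
  occ t L ≡ occ t (take p L) + (⟦ nth L p ≡ᵇ t ⟧ + occ t (drop (suc p) L))
occ-split t L p p< = begin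
  occ t L                                                    ≡⟨ cong (occ t) (Listₚ.take++drop≡id p L) ⟨
  occ t (take p L ++ drop p L)                               ≡⟨ occ-++ t (take p L) (drop p L) ⟩
  occ t (take p L) + occ t (drop p L)                        ≡⟨ cong (λ z → occ t (take p L) + occ t z) (drop≡nth∷drop L p p<) ⟩
  occ t (take p L) + occ t (nth L p ∷ drop (suc p) L)        ≡⟨ cong (occ t (take p L) +_) (occ-∷ t (nth L p) _) ⟩
  occ t (take p L) + (⟦ nth L p ≡ᵇ t ⟧ + occ t (drop (suc p) L)) ∎
  where open ≡-Reasoning

module _ (k′ n : ℕ) where
  private
    k = suc k′
    N = suc n

  -- The block contributes every label once and removes the label j of the gap it fills.
  weight-insertBlock : ∀ σ p → All (_< N) σ → p ≤ length σ →
    weight k (insertBlock k N p σ) ≡ bump (weight k σ) (nth (labels k σ) p)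
  weight-insertBlock σ p σ<N p≤ = lookup-ext _ _ pointwise
    where
    L = labels k σ
    j = nth L p
    p<len : p < length L
    p<len = subst (p <_) (sym (length-labelsFrom k [] 0 σ)) (s≤s p≤)
    pointwise : ∀ t → lookup (weight k (insertBlock k N p σ)) t ≡ lookup (bump (weight k σ) j) t
    pointwise t = begin
      lookup (weight k (insertBlock k N p σ)) t    ≡⟨ weight≡occ-labels k′ (insertBlock k N p σ) t ⟩
      occ tn (labels k (insertBlock k N p σ))      ≡⟨ cong (occ tn) (labels-insertBlock k′ n p σ p≤ σ<N) ⟩
      occ tn (take p L ++ blockLabels k′ ++ drop (suc p) L)
                                                   ≡⟨ occ-++ tn (take p L) _ ⟩
      A + occ tn (blockLabels k′ ++ drop (suc p) L) ≡⟨ cong (A +_) (occ-++ tn (blockLabels k′) _) ⟩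
      A + (occ tn (blockLabels k′) + B)            ≡⟨ cong (λ z → A + (z + B)) (occ-blockLabels k′ tn (ℕₚ.≤-pred (Finₚ.toℕ<n t))) ⟩
      A + suc B                                    ≡⟨ replaced ⟩
      suc (if tn ≡ᵇ j then occ tn L ∸ 1 else occ tn L)
                                                   ≡⟨ cong (λ z → suc (if tn ≡ᵇ j then z ∸ 1 else z)) (weight≡occ-labels k′ σ t) ⟨
      suc (if tn ≡ᵇ j then lookup (weight k σ) t ∸ 1 else lookup (weight k σ) t)
                                                   ≡⟨ lookup-bump (weight k σ) j t ⟨
      lookup (bump (weight k σ) j) t               ∎
      where
      open ≡-Reasoning
      tn = toℕ t
      A = occ tn (take p L)
      B = occ tn (drop (suc p) L)
      replaced : A + suc B ≡ suc (if tn ≡ᵇ j then occ tn L ∸ 1 else occ tn L)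
      replaced rewrite occ-split tn L p p<len with tn ≡ᵇ j in tn≡ᵇj
      ... | true rewrite dec-true (j ℕ.≟ tn) (sym (invert-true (tn ℕ.≟ j) tn≡ᵇj)) = trans (ℕₚ.+-suc A B) (cong (λ z → suc (z ∸ 1)) (sym (ℕₚ.+-suc A B)))
      ... | false rewrite ≢⇒≡ᵇ-false (invert-false (tn ℕ.≟ j) tn≡ᵇj ∘ sym) = ℕₚ.+-suc A B

-- The recurrence for the number of Stirling permutations of a given weight

∑-upTo-suc : ∀ m (h : ℕ → ℕ) → ∑ (upTo (suc m)) h ≡ h 0 + ∑ (upTo m) (h ∘ suc)
∑-upTo-suc m h = cong (h 0 +_) (trans (cong (λ z → ∑ z h) (sym (Listₚ.map-upTo suc m))) (∑-map suc (upTo m) h))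

∑-allFin : ∀ m (h : ℕ → ℕ) → ∑ (allFin m) (h ∘ toℕ) ≡ ∑ (upTo m) h
∑-allFin zero h = refl
∑-allFin (suc m) h = trans (cong (h 0 +_) (begin
    ∑ (List.tabulate {n = m} Fin.suc) (h ∘ toℕ) ≡⟨ cong (λ z → ∑ z (h ∘ toℕ)) (Listₚ.map-tabulate {n = m} (λ i → i) Fin.suc) ⟨
    ∑ (map Fin.suc (allFin m)) (h ∘ toℕ)      ≡⟨ ∑-map Fin.suc (allFin m) (h ∘ toℕ) ⟩
    ∑ (allFin m) (h ∘ suc ∘ toℕ)              ≡⟨ ∑-allFin m (h ∘ suc) ⟩
    ∑ (upTo m) (h ∘ suc)                      ∎))
  (sym (∑-upTo-suc m h))
  where open ≡-Reasoning

∑-nth : ∀ (L : List ℕ) (g : ℕ → ℕ) → ∑ (upTo (length L)) (g ∘ nth L) ≡ ∑ L g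
∑-nth [] g = refl
∑-nth (x ∷ L) g = trans (∑-upTo-suc (length L) (g ∘ nth (x ∷ L))) (cong (g x +_) (∑-nth L g))

∑-indicator : ∀ m x (g : ℕ → ℕ) → x < m → ∑ (upTo m) (λ t → ⟦ x ≡ᵇ t ⟧ * g t) ≡ g x
∑-indicator (suc m) zero g _ = begin
  ∑ (upTo (suc m)) (λ t → ⟦ 0 ≡ᵇ t ⟧ * g t)   ≡⟨ ∑-upTo-suc m (λ t → ⟦ 0 ≡ᵇ t ⟧ * g t) ⟩
  g 0 + 0 + ∑ (upTo m) (λ _ → 0)             ≡⟨ cong (g 0 + 0 +_) (∑-0 (upTo m)) ⟩
  g 0 + 0 + 0                                ≡⟨ trans (ℕₚ.+-identityʳ _) (ℕₚ.+-identityʳ _) ⟩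
  g 0                                        ∎
  where open ≡-Reasoning
∑-indicator (suc m) (suc x) g (s≤s x<m) =
  trans (∑-upTo-suc m (λ t → ⟦ suc x ≡ᵇ t ⟧ * g t)) (∑-indicator m x (g ∘ suc) x<m)

∑-histogram : ∀ m (L : List ℕ) (g : ℕ → ℕ) → All (_< m) L → ∑ L g ≡ ∑ (upTo m) (λ t → occ t L * g t)
∑-histogram m [] g _ = sym (∑-0 (upTo m))
∑-histogram m (x ∷ L) g (x<m ∷ L<m) = begin
  g x + ∑ L g
    ≡⟨ cong₂ _+_ (sym (∑-indicator m x g x<m)) (∑-histogram m L g L<m) ⟩
  ∑ (upTo m) (λ t → ⟦ x ≡ᵇ t ⟧ * g t) + ∑ (upTo m) (λ t → occ t L * g t)
    ≡⟨ ∑-+ (upTo m) _ _ ⟨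
  ∑ (upTo m) (λ t → ⟦ x ≡ᵇ t ⟧ * g t + occ t L * g t)
    ≡⟨ ∑-cong (upTo m) (λ {t} _ → trans (sym (ℕₚ.*-distribʳ-+ (g t) ⟦ x ≡ᵇ t ⟧ (occ t L))) (cong (_* g t) (sym (occ-∷ t x L)))) ⟩
  ∑ (upTo m) (λ t → occ t (x ∷ L) * g t) ∎
  where open ≡-Reasoning

count𝒬 : (k : ℕ) → ℕ → Monomial (suc k) → ℕ
count𝒬 k n μ = ∑ (𝒬 n k) (λ σ → δ (weight k σ) μ)

module _ (k′ n : ℕ) where
  private
    k = suc k′
    N = suc n

  -- The junk label k + 1 does not occur; this is carried along the induction.
  LabelsBounded : Set
  LabelsBounded = ∀ σ → σ ∈ 𝒬 n k → All (_< suc k) (labels k σ)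

  ∑-insertBlock : LabelsBounded → ∀ μ σ → σ ∈ 𝒬 n k →
    ∑ (map (λ p → insertBlock k N p σ) (upTo (suc (k * n)))) (λ w → δ (weight k w) μ)
      ≡ ∑ (allFin (suc k)) (λ i → leibnizCoeff i μ * δ (weight k σ) (lower i μ))
  ∑-insertBlock bounded μ σ σ∈ = begin
    ∑ (map (λ p → insertBlock k N p σ) (upTo (suc (k * n)))) (λ w → δ (weight k w) μ)
      ≡⟨ ∑-map (λ p → insertBlock k N p σ) (upTo (suc (k * n))) (λ w → δ (weight k w) μ) ⟩
    ∑ (upTo (suc (k * n))) (λ p → δ (weight k (insertBlock k N p σ)) μ)
      ≡⟨ ∑-cong (upTo (suc (k * n))) (λ {p} p∈ → cong (λ z → δ z μ)
           (weight-insertBlock k′ n σ p σ<N (subst (p ≤_) (sym (IsStirlingPerm.length≡ perm)) (ℕₚ.≤-pred (∈-upTo⁻ p∈))))) ⟩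
    ∑ (upTo (suc (k * n))) (g ∘ nth L)    ≡⟨ cong (λ z → ∑ (upTo z) (g ∘ nth L)) length-L ⟨
    ∑ (upTo (length L)) (g ∘ nth L)       ≡⟨ ∑-nth L g ⟩
    ∑ L g                                 ≡⟨ ∑-histogram (suc k) L g (bounded σ σ∈) ⟩
    ∑ (upTo (suc k)) (λ t → occ t L * g t)
      ≡⟨ ∑-allFin (suc k) (λ t → occ t L * g t) ⟨
    ∑ (allFin (suc k)) (λ i → occ (toℕ i) L * g (toℕ i))
      ≡⟨ ∑-cong (allFin (suc k)) (λ {i} _ → trans (cong (_* g (toℕ i)) (sym (weight≡occ-labels k′ σ i))) (leibniz-δ W μ i)) ⟩
    ∑ (allFin (suc k)) (λ i → leibnizCoeff i μ * δ W (lower i μ)) ∎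
    where
    open ≡-Reasoning
    perm = ∈𝒬⇒IsStirlingPerm {k} σ∈
    σ<N = All.map Letter⇒< (IsStirlingPerm.letters perm)
    W = weight k σ
    L = labels k σ
    g : ℕ → ℕ
    g j = δ (bump W j) μ
    length-L : length L ≡ suc (k * n)
    length-L = trans (length-labelsFrom k [] 0 σ) (cong suc (IsStirlingPerm.length≡ perm))

  count𝒬-suc : LabelsBounded → ∀ μ →
    count𝒬 k N μ ≡ ∑ (allFin (suc k)) (λ i → leibnizCoeff i μ * count𝒬 k n (lower i μ))
  count𝒬-suc bounded μ = begin
    ∑ (𝒬 N k) f                                                ≡⟨ ∑-↭ f (𝒬-suc↭insertions k′ n) ⟩
    ∑ (insertions k n) f                                       ≡⟨ ∑-concatMap _ (𝒬 n k) f ⟩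
    ∑ (𝒬 n k) (λ σ → ∑ (map (λ p → insertBlock k N p σ) (upTo (suc (k * n)))) f)
                                                               ≡⟨ ∑-cong (𝒬 n k) (∑-insertBlock bounded μ _) ⟩
    ∑ (𝒬 n k) (λ σ → ∑ (allFin (suc k)) (λ i → c i * δ (weight k σ) (lower i μ)))
                                                               ≡⟨ ∑-comm (𝒬 n k) (allFin (suc k)) _ ⟩
    ∑ (allFin (suc k)) (λ i → ∑ (𝒬 n k) (λ σ → c i * δ (weight k σ) (lower i μ)))
                                                               ≡⟨ ∑-cong (allFin (suc k)) (λ {i} _ → ∑-*ˡ (𝒬 n k) (c i) _) ⟩
    ∑ (allFin (suc k)) (λ i → c i * count𝒬 k n (lower i μ))   ∎
    where
    open ≡-Reasoning
    f : List ℕ → ℕ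
    f w = δ (weight k w) μ
    c = λ i → leibnizCoeff i μ

  blockLabels-bounded : All (_< suc k) (blockLabels k′)
  blockLabels-bounded = ℕₚ.≤-refl ∷ Allₚ.++⁺ (ascending-< 0 k′ ℕₚ.≤-refl) (s≤s (ℕₚ.n≤1+n k′) ∷ [])
    where
    ascending-< : ∀ c j → c + j ≤ k′ → All (_< suc k) (ascending c j)
    ascending-< c zero _ = []
    ascending-< c (suc j) c+j≤ = s≤s (ℕₚ.≤-trans (ℕₚ.m≤m+n c (suc j)) (ℕₚ.≤-trans c+j≤ (ℕₚ.n≤1+n k′)))
      ∷ ascending-< (suc c) j (subst (_≤ k′) (ℕₚ.+-suc c j) c+j≤)

  labelsBounded-suc : LabelsBounded → ∀ w → w ∈ 𝒬 N k → All (_< suc k) (labels k w)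
  labelsBounded-suc bounded w w∈ with IsStirlingPerm-removeBlock k′ n w (∈𝒬⇒IsStirlingPerm {k} w∈)
  ... | σ , p , perm , p≤ , refl =
    subst (All (_< suc k))
      (sym (labels-insertBlock k′ n p σ (subst (p ≤_) (sym (IsStirlingPerm.length≡ perm)) p≤)
                                         (All.map Letter⇒< (IsStirlingPerm.letters perm))))
      (Allₚ.++⁺ (Allₚ.take⁺ p L<) (Allₚ.++⁺ blockLabels-bounded (Allₚ.drop⁺ (suc p) L<)))
    where
    L< = bounded σ (IsStirlingPerm⇒∈𝒬 perm)

coeff-C : ∀ k n μ → coeff (C k n) μ ≡ ℕtoℚ (count𝒬 k n μ)
coeff-C k n μ = begin
  coeff (C k n) μ                                         ≡⟨ coeff-map (λ σ → (1ℚ , weight k σ)) (𝒬 n k) μ ⟩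
  ∑ℚ (𝒬 n k) (λ σ → termCoeff (1ℚ , weight k σ) μ)        ≡⟨ ∑ℚ-cong (𝒬 n k) (λ σ → termCoeff-δ 1ℚ (weight k σ) μ) ⟩
  ∑ℚ (𝒬 n k) (λ σ → 1ℚ ℚ.* ℕtoℚ (δ (weight k σ) μ))      ≡⟨ ∑ℚ-cong (𝒬 n k) (λ σ → ℚₚ.*-identityˡ _) ⟩
  ∑ℚ (𝒬 n k) (λ σ → ℕtoℚ (δ (weight k σ) μ))             ≡⟨ ℕtoℚ-∑ (𝒬 n k) (λ σ → δ (weight k σ) μ) ⟨
  ℕtoℚ (count𝒬 k n μ)                                     ∎
  where open ≡-Reasoning

module _ (k′ : ℕ) where
  private
    k = suc k′
    m = suc k

  block₁ : List ℕ
  block₁ = insertBlock k 1 0 []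

  labels-block₁ : labels k block₁ ≡ blockLabels k′
  labels-block₁ = trans (labels-insertBlock k′ 0 0 [] z≤n []) (Listₚ.++-identityʳ (blockLabels k′))

  𝒬₁-block₁ : ∀ {w} → w ∈ 𝒬 1 k → w ≡ block₁
  𝒬₁-block₁ w∈ with IsStirlingPerm-removeBlock k′ 0 _ (∈𝒬⇒IsStirlingPerm {k} w∈)
  ... | [] , zero , _ , _ , refl = refl
  ... | [] , suc p , _ , p≤ , _ with () ← subst (suc p ≤_) (ℕₚ.*-zeroʳ k) p≤
  ... | x ∷ σ , _ , perm , _ , _ with () ← trans (IsStirlingPerm.length≡ perm) (ℕₚ.*-zeroʳ k)

  block₁∈𝒬₁ : block₁ ∈ 𝒬 1 k
  block₁∈𝒬₁ = IsStirlingPerm⇒∈𝒬 (IsStirlingPerm-insertBlock k′ 0 [] 0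
    (isStirlingPerm (sym (ℕₚ.*-zeroʳ k)) [] (λ { _ (s≤s _) () }) (λ ())))

  𝒬₁↭ : 𝒬 1 k ↭ block₁ ∷ []
  𝒬₁↭ = unique-↭ (𝒬-unique 1 k) ([] ∷ []) (λ w∈ → here (𝒬₁-block₁ w∈)) (λ { (here refl) → block₁∈𝒬₁ })

  labelsBounded₁ : LabelsBounded k′ 1
  labelsBounded₁ σ σ∈ rewrite 𝒬₁-block₁ σ∈ | labels-block₁ = blockLabels-bounded k′ 0

  weight-block₁ : weight k block₁ ≡ e
  weight-block₁ = lookup-ext _ _ λ t → begin
    lookup (weight k block₁) t            ≡⟨ weight≡occ-labels k′ block₁ t ⟩
    occ (toℕ t) (labels k block₁)         ≡⟨ cong (occ (toℕ t)) labels-block₁ ⟩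
    occ (toℕ t) (blockLabels k′)          ≡⟨ occ-blockLabels k′ (toℕ t) (ℕₚ.≤-pred (Finₚ.toℕ<n t)) ⟩
    1                                     ≡⟨ Vecₚ.lookup∘tabulate (λ _ → 1) t ⟨
    lookup e t                            ∎
    where open ≡-Reasoning

  count𝒬₁ : ∀ μ → count𝒬 k 1 μ ≡ δ e μ + 0
  count𝒬₁ μ = trans (∑-↭ (λ σ → δ (weight k σ) μ) 𝒬₁↭) (cong (λ ν → δ ν μ + 0) weight-block₁)

  x₁ : Monomial m
  x₁ = tabulate (λ s → if does (toℕ s ℕ.≟ 0) then 1 else 0)

  bump-x₁ : bump x₁ 0 ≡ e
  bump-x₁ = lookup-ext _ _ λ { zero → refl ; (Fin.suc s) → trans (lookup-bump x₁ 0 (Fin.suc s))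
    (trans (cong suc (Vecₚ.lookup∘tabulate (λ s → if does (toℕ s ℕ.≟ 0) then 1 else 0) (Fin.suc s)))
           (sym (Vecₚ.lookup∘tabulate {n = m} (λ _ → 1) (Fin.suc s)))) }

  -- D x₁ = e: only the Leibniz term of x₁ survives.
  coeff-D-x₁ : ∀ μ → coeff (D (var {m} zero)) μ ≡ ℕtoℚ (count𝒬 k 1 μ)
  coeff-D-x₁ μ = begin
    coeff (Dterm (1ℚ , x₁) ++ []) μ                      ≡⟨ coeff-++ (Dterm (1ℚ , x₁)) [] μ ⟩
    coeff (Dterm (1ℚ , x₁)) μ ℚ.+ 0ℚ                     ≡⟨ ℚₚ.+-identityʳ _ ⟩
    coeff (Dterm (1ℚ , x₁)) μ                            ≡⟨ coeff-map term (allFin m) μ ⟩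
    termCoeff (1ℚ ℚ.* 1ℚ , bump x₁ 0) μ ℚ.+ ∑ℚ (List.tabulate {n = k} Fin.suc) (λ i → termCoeff (term i) μ)
      ≡⟨ cong₂ ℚ._+_ (cong₂ (λ c ν → termCoeff (c , ν) μ) (ℚₚ.*-identityˡ 1ℚ) bump-x₁)
                     (∑ℚ-0 (List.tabulate {n = k} Fin.suc) (λ i → termCoeff (term i) μ) vanishing) ⟩
    termCoeff (1ℚ , e) μ ℚ.+ 0ℚ                          ≡⟨ cong (ℚ._+ 0ℚ) (trans (termCoeff-δ 1ℚ e μ) (ℚₚ.*-identityˡ (ℕtoℚ (δ e μ)))) ⟩
    ℕtoℚ (δ e μ) ℚ.+ ℕtoℚ 0                              ≡⟨ ℕtoℚ-+ (δ e μ) 0 ⟨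
    ℕtoℚ (δ e μ + 0)                                     ≡⟨ cong ℕtoℚ (count𝒬₁ μ) ⟨
    ℕtoℚ (count𝒬 k 1 μ)                                  ∎
    where
    open ≡-Reasoning
    term : Fin m → ℚ × Monomial m
    term i = 1ℚ ℚ.* ℕtoℚ (lookup x₁ i) , bump x₁ (toℕ i)
    vanishing : ∀ {i} → i ∈ List.tabulate {n = k} Fin.suc → termCoeff (term i) μ ≡ 0ℚ
    vanishing i∈ with ∈-tabulate⁻ {f = Fin.suc} i∈
    ... | i , refl rewrite Vecₚ.lookup∘tabulate (λ s → if does (toℕ s ℕ.≟ 0) then 1 else 0) (Fin.suc i)
                         | ℚₚ.*-zeroʳ 1ℚ = trans (termCoeff-δ 0ℚ ν μ) (ℚₚ.*-zeroˡ (ℕtoℚ (δ ν μ)))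
      where ν = bump x₁ (toℕ (Fin.suc i))

  coeff-D-step : ∀ n (p : Poly m) → LabelsBounded k′ n → (∀ μ → coeff p μ ≡ ℕtoℚ (count𝒬 k n μ)) →
    ∀ μ → coeff (D p) μ ≡ ℕtoℚ (count𝒬 k (suc n) μ)
  coeff-D-step n p bounded coeff-p μ = begin
    coeff (D p) μ                                           ≡⟨ coeff-D p μ ⟩
    ∑ℚ (allFin m) (λ i → ℕtoℚ (c i) ℚ.* coeff p (lower i μ)) ≡⟨ ∑ℚ-cong (allFin m) (λ i →
                                                                 trans (cong (ℕtoℚ (c i) ℚ.*_) (coeff-p (lower i μ))) (sym (ℕtoℚ-* (c i) (count𝒬 k n (lower i μ))))) ⟩
    ∑ℚ (allFin m) (λ i → ℕtoℚ (c i * count𝒬 k n (lower i μ))) ≡⟨ ℕtoℚ-∑ (allFin m) (λ i → c i * count𝒬 k n (lower i μ)) ⟨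
    ℕtoℚ (∑ (allFin m) (λ i → c i * count𝒬 k n (lower i μ))) ≡⟨ cong ℕtoℚ (count𝒬-suc k′ n bounded μ) ⟨
    ℕtoℚ (count𝒬 k (suc n) μ)                               ∎
    where
    open ≡-Reasoning
    c = λ i → leibnizCoeff i μ

  coeff-Dⁿ-x₁ : ∀ n → LabelsBounded k′ (suc n) × (∀ μ → coeff (Dⁿ (suc n) (var {m} zero)) μ ≡ ℕtoℚ (count𝒬 k (suc n) μ))
  coeff-Dⁿ-x₁ zero = labelsBounded₁ , coeff-D-x₁
  coeff-Dⁿ-x₁ (suc n) =
    labelsBounded-suc k′ (suc n) (proj₁ IH) , coeff-D-step (suc n) (Dⁿ (suc n) (var zero)) (proj₁ IH) (proj₂ IH)
    where IH = coeff-Dⁿ-x₁ n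

lemma4p4 : (k : ℕ) → 1 ≤ k → (n : ℕ) → 1 ≤ n →
    Dⁿ {suc k} n (var zero) ≈ₚ C k n
lemma4p4 (suc k′) _ (suc n) _ μ = begin
  coeff (Dⁿ (suc n) (var zero)) μ      ≡⟨ proj₂ (coeff-Dⁿ-x₁ k′ n) μ ⟩
  ℕtoℚ (count𝒬 (suc k′) (suc n) μ)     ≡⟨ coeff-C (suc k′) (suc n) μ ⟨
  coeff (C (suc k′) (suc n)) μ         ∎
  where open ≡-Reasoning
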